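{- Let $d\ge2$, $\alpha=\frac{d+\sqrt{d^2+4}}{2}$, and let $(A_{m,n})$ be the $d$-Ostrowski array. Then the first column is the non-homogeneous Beatty sequence \[A_{m,1}=\left\lfloor m\cdot\frac{\alpha}{\alpha-1}-\frac{1}{\alpha(\alpha-1)}\right\rfloor,\qquad m\ge1.\]
   Context: Define $(D_n)$ by $D_0=0$, $D_1=1$, $D_{n+1}=dD_n+D_{n-1}$. An Ostrowski word is a finite word $d_1\cdots d_i$ over $\{0,\dots,d\}$ with $0\le d_1<d$, $0\le d_j\le d$ for $j>1$, and $d_{j-1}=0$ whenever $d_j=d$; it represents $\sum_j d_jD_j$. Every non-negative integer has a unique Ostrowski word with nonzero last digit. An Ostrowski word is trimmed if its last digit is nonzero and it cannot be written as $0v$ with $v$ an Ostrowski word (equivalently, its first digit is nonzero, or its first two digits are $0$ and $d$). Let $w_1,w_2,\dots$ be the trimmed Ostrowski words listed in increasing order of the integers they represent. The $d$-Ostrowski array is $A_{m,n}=$ the integer represented by $0^{n-1}w_m$, for $m,n\ge1$. -}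

module Defs where

open import Data.Nat as ℕ using (ℕ; zero; suc)
open import Data.Integer as ℤ using (ℤ; +_; +[1+_]; -[1+_])
open import Data.Rational.Unnormalised as Q using (ℚᵘ; mkℚᵘ; 0ℚᵘ; 1ℚᵘ)
open import Data.List using (List; []; _∷_; length; replicate; _++_)
open import Data.List.Relation.Unary.All using (All)
open import Data.List.Relation.Unary.Unique.Propositional using (Unique)
open import Data.List.Membership.Propositional using (_∈_)
open import Data.Product using (Σ; _×_; ∃)
open import Data.Sum using (_⊎_)
open import Data.Unit using (⊤)
open import Data.Empty using (⊥)
open import Relation.Nullary using (¬_)
open import Relation.Binary.PropositionalEquality using (_≡_; _≢_)

Dseq : ℕ → ℕ → ℕ
Dseq d zero = 0
Dseq d (suc zero) = 1
Dseq d (suc (suc n)) = d ℕ.* Dseq d (suc n) ℕ.+ Dseq d n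

-- Words d_1 d_2 ... d_i are lists of digits, head = d_1.

OstTail : ℕ → ℕ → List ℕ → Set
OstTail d prev [] = ⊤
OstTail d prev (y ∷ ys) = (y ℕ.≤ d) × ((y ≡ d) → prev ≡ 0) × OstTail d y ys

IsOstrowski : ℕ → List ℕ → Set
IsOstrowski d [] = ⊤
IsOstrowski d (x ∷ xs) = (x ℕ.< d) × OstTail d x xs

LastNonzero : List ℕ → Set
LastNonzero [] = ⊥
LastNonzero (x ∷ []) = x ≢ 0
LastNonzero (x ∷ y ∷ ys) = LastNonzero (y ∷ ys)

valueFrom : ℕ → ℕ → List ℕ → ℕ
valueFrom d j [] = 0
valueFrom d j (x ∷ xs) = x ℕ.* Dseq d j ℕ.+ valueFrom d (suc j) xs

value : ℕ → List ℕ → ℕ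
value d w = valueFrom d 1 w

Trimmed : ℕ → List ℕ → Set
Trimmed d w = IsOstrowski d w × LastNonzero w
            × ¬ (Σ (List ℕ) λ v → (w ≡ 0 ∷ v) × IsOstrowski d v)

-- w is the m-th trimmed word (m ≥ 1) in increasing order of value:
-- exactly m-1 (distinct) trimmed words have smaller value.
IsMthTrimmed : ℕ → ℕ → List ℕ → Set
IsMthTrimmed d m w =
  Trimmed d w ×
  Σ (List (List ℕ)) λ L →
    Unique L × (length L ≡ m ℕ.∸ 1)
    × All (λ v → Trimmed d v × (value d v ℕ.< value d w)) L
    × (∀ v → Trimmed d v → value d v ℕ.< value d w → v ∈ L)

OstrowskiArrayEntry : ℕ → ℕ → ℕ → ℕ → Set
OstrowskiArrayEntry d m n a =
  Σ (List ℕ) λ w → IsMthTrimmed d m w × (a ≡ value d (replicate (n ℕ.∸ 1) 0 ++ w))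

-- The quadratic field ℚ(√D): elements a + b√D with a, b ∈ ℚ (D a fixed
-- natural number; below D = d² + 4, which is not a perfect square).

record QSqrt : Set where
  constructor ⟨_,_⟩
  field
    re : ℚᵘ
    ir : ℚᵘ
open QSqrt public

fromℤ : ℤ → QSqrt
fromℤ k = ⟨ k Q./ 1 , 0ℚᵘ ⟩

_⊕_ : QSqrt → QSqrt → QSqrt
x ⊕ y = ⟨ re x Q.+ re y , ir x Q.+ ir y ⟩

⊖_ : QSqrt → QSqrt
⊖ x = ⟨ Q.- re x , Q.- ir x ⟩

_⊝_ : QSqrt → QSqrt → QSqrt
x ⊝ y = x ⊕ (⊖ y)

mul : ℕ → QSqrt → QSqrt → QSqrt
mul D x y = ⟨ re x Q.* re y Q.+ (+ D Q./ 1) Q.* (ir x Q.* ir y)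
            , re x Q.* ir y Q.+ ir x Q.* re y ⟩

-- reciprocal in ℚᵘ, with 1/0 := 0 (only used on nonzero arguments)
recipQ : ℚᵘ → ℚᵘ
recipQ (mkℚᵘ (+ zero) d) = 0ℚᵘ
recipQ (mkℚᵘ +[1+ n ] d) = mkℚᵘ +[1+ d ] n
recipQ (mkℚᵘ -[1+ n ] d) = mkℚᵘ -[1+ d ] n

-- inverse in ℚ(√D): (a + b√D)⁻¹ = (a - b√D)/(a² - D b²)
-- (for D not a square, a² - D b² ≠ 0 whenever a + b√D ≠ 0)
inv : ℕ → QSqrt → QSqrt
inv D x = ⟨ re x Q.* r , Q.- (ir x Q.* r) ⟩
  where r = recipQ (re x Q.* re x Q.- (+ D Q./ 1) Q.* (ir x Q.* ir x))

divide : ℕ → QSqrt → QSqrt → QSqrt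
divide D x y = mul D x (inv D y)

-- a + b√D ≥ 0 (real order, √D the nonnegative square root)
NonNeg : ℕ → QSqrt → Set
NonNeg D x =
    (0ℚᵘ Q.≤ re x × 0ℚᵘ Q.≤ ir x)
  ⊎ (0ℚᵘ Q.≤ re x × ir x Q.< 0ℚᵘ
       × ((+ D Q./ 1) Q.* (ir x Q.* ir x) Q.≤ re x Q.* re x))
  ⊎ (re x Q.< 0ℚᵘ × 0ℚᵘ Q.≤ ir x
       × (re x Q.* re x Q.≤ (+ D Q./ 1) Q.* (ir x Q.* ir x)))

Leq : ℕ → QSqrt → QSqrt → Set
Leq D x y = NonNeg D (y ⊝ x)

Less : ℕ → QSqrt → QSqrt → Set
Less D x y = ¬ Leq D y x

IsFloor : ℕ → ℤ → QSqrt → Set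
IsFloor D k x = Leq D (fromℤ k) x × Less D x (fromℤ (k ℤ.+ + 1))

-- α = (d + √(d²+4))/2 as an element of ℚ(√(d²+4))

discr : ℕ → ℕ
discr d = d ℕ.* d ℕ.+ 4

alpha : ℕ → QSqrt
alpha d = ⟨ + d Q./ 2 , + 1 Q./ 2 ⟩

beattyArg : ℕ → ℕ → QSqrt
beattyArg d m =
  divide D (mul D (fromℤ (+ m)) α) (α ⊝ fromℤ (+ 1))
  ⊝ divide D (fromℤ (+ 1)) (mul D α (α ⊝ fromℤ (+ 1)))
  where
    D = discr d
    α = alpha d

-- Let shift k be the value of 0 w, where w is the Ostrowski word of k.  A word
-- is trimmed exactly when its value is not shift k for any k ≥ 1, so A_{m,1} is
-- the m-th positive integer n outside the image of shift.  Induction over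
-- Ostrowski words gives shift k + d < α (k + 1) < shift k + d + 1; with K the
-- number of shifts up to n this yields n = m + K and
-- α (K + 1) < n + d < n + d + 1 < α (K + 2), which rearranges to
-- n ≤ m α/(α - 1) - 1/(α(α - 1)) < n + 1.  Without real numbers, p + qα > 0 is
-- read off the eventual sign of p Dₙ + q Dₙ₊₁ and transferred to ℚ(√(d² + 4))
-- through the norm form and the Cassini identity.
module Submission where

open import Defs
open import Data.Nat as ℕ using (ℕ)
import Data.Nat.Properties as ℕP
open import Data.List using (List; length)
open import Data.List.Relation.Unary.Unique.Propositional using (Unique)
open import Data.List.Membership.Propositional using (_∈_)
open import Data.List.Membership.Propositional.Properties.WithK using (unique∧set⇒bag)
open import Data.List.Relation.Binary.BagAndSetEquality using (∼bag⇒↭)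
open import Data.List.Relation.Binary.Permutation.Propositional.Properties using (↭-length)
open import Function.Bundles using (mk⇔)
open import Data.Integer as ℤ using (ℤ; +_; 0ℤ)
open import Data.Product using (_×_; _,_; proj₁; proj₂)
open import Data.Sum using (_⊎_)
open import Data.Rational.Unnormalised as ℚᵘ using (ℚᵘ)
open import Relation.Binary.PropositionalEquality using (_≡_)

module IntegerSigns where

  open import Data.Nat using (zero; z≤n; s≤s)
  open import Data.Integer using (+_; +[1+_]; -[1+_]; _+_; _*_; -_; _-_; 0ℤ; +≤+; +<+; _≤_; _<_)
  import Data.Integer.Properties as ℤP
  open import Data.Integer.Tactic.RingSolver using (solve-∀)
  open import Data.Product using (Σ; _,_)
  open import Data.Empty using (⊥-elim)
  open import Relation.Binary.PropositionalEquality

  private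
    0<⇒ : ∀ {a} → 0ℤ < a → Σ ℕ λ n → a ≡ +[1+ n ]
    0<⇒ {+[1+ n ]} _ = n , refl
    0<⇒ {+ zero} (+<+ ())

    0≤⇒ : ∀ {a} → 0ℤ ≤ a → Σ ℕ λ n → a ≡ + n
    0≤⇒ {+ n} _ = n , refl

  0≤pos : ∀ n → 0ℤ ≤ + n
  0≤pos n = +≤+ z≤n

  0≤+ : ∀ {a b} → 0ℤ ≤ a → 0ℤ ≤ b → 0ℤ ≤ a + b
  0≤+ p q with 0≤⇒ p | 0≤⇒ q
  ... | n , refl | k , refl = subst (0ℤ ≤_) (ℤP.pos-+ n k) (0≤pos _)

  0<+ : ∀ {a b} → 0ℤ < a → 0ℤ ≤ b → 0ℤ < a + b
  0<+ p q with 0<⇒ p | 0≤⇒ q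
  ... | n , refl | k , refl = +<+ (s≤s z≤n)

  0≤<+ : ∀ {a b} → 0ℤ ≤ a → 0ℤ < b → 0ℤ < a + b
  0≤<+ {a} {b} p q = subst (0ℤ <_) (ℤP.+-comm b a) (0<+ q p)

  0≤* : ∀ {a b} → 0ℤ ≤ a → 0ℤ ≤ b → 0ℤ ≤ a * b
  0≤* p q with 0≤⇒ p | 0≤⇒ q
  ... | n , refl | k , refl = subst (0ℤ ≤_) (ℤP.pos-* n k) (0≤pos _)

  0<* : ∀ {a b} → 0ℤ < a → 0ℤ < b → 0ℤ < a * b
  0<* p q with 0<⇒ p | 0<⇒ q
  ... | n , refl | k , refl = +<+ (s≤s z≤n)

  0<*-cancelˡ : ∀ {x y} → 0ℤ ≤ x → 0ℤ < x * y → 0ℤ < y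
  0<*-cancelˡ {x} {+[1+ n ]} hx h = +<+ (s≤s z≤n)
  0<*-cancelˡ {x} {+ zero} hx h = ⊥-elim (ℤP.<-irrefl (sym (ℤP.*-zeroʳ x)) h)
  0<*-cancelˡ {+ zero} { -[1+ n ]} hx (+<+ ())
  0<*-cancelˡ {+[1+ k ]} { -[1+ n ]} hx ()

  0<-⇒< : ∀ {a b} → 0ℤ < b - a → a < b
  0<-⇒< {a} {b} p = subst₂ _<_ (ℤP.+-identityˡ a) (lemma a b) (ℤP.+-monoˡ-< a p)
    where
    lemma : ∀ a b → (b - a) + a ≡ b
    lemma = solve-∀

  <⇒0<- : ∀ {a b} → a < b → 0ℤ < b - a
  <⇒0<- {a} {b} h = subst (_< b - a) (ℤP.+-inverseʳ a) (ℤP.+-monoˡ-< (- a) h)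

Dseq-suc-pos : ∀ {d} → 1 ℕ.≤ d → ∀ k → 1 ℕ.≤ Dseq d (ℕ.suc k)
Dseq-suc-pos h ℕ.zero = ℕP.≤-refl
Dseq-suc-pos {d} h (ℕ.suc k) = begin
  1                        ≤⟨ Dseq-suc-pos h k ⟩
  Dseq d (ℕ.suc k)         ≤⟨ ℕP.m≤n*m (Dseq d (ℕ.suc k)) d ⦃ ℕ.>-nonZero h ⦄ ⟩
  d ℕ.* Dseq d (ℕ.suc k)   ≤⟨ ℕP.m≤m+n _ _ ⟩
  Dseq d (ℕ.suc (ℕ.suc k)) ∎
  where open ℕP.≤-Reasoning

divMod-unique : ∀ {M x x′ a a′} .{{_ : ℕ.NonZero M}} → a ℕ.< M → a′ ℕ.< M →
                a ℕ.+ x ℕ.* M ≡ a′ ℕ.+ x′ ℕ.* M → a ≡ a′ × x ≡ x′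
divMod-unique {M} {x} {x′} {a} {a′} a<M a′<M eq =
  a≡a′ , ℕP.*-cancelʳ-≡ x x′ M (ℕP.+-cancelˡ-≡ a _ _ (trans eq (cong (λ z → z ℕ.+ x′ ℕ.* M) (sym a≡a′))))
  where
  open import Data.Nat.DivMod using (_%_; m<n⇒m%n≡m; [m+kn]%n≡m%n)
  open import Relation.Binary.PropositionalEquality using (cong; sym; trans; module ≡-Reasoning)
  open ≡-Reasoning
  a≡a′ : a ≡ a′
  a≡a′ = begin
    a                ≡⟨ sym (m<n⇒m%n≡m a<M) ⟩
    a % M            ≡⟨ sym ([m+kn]%n≡m%n a x M) ⟩
    (a ℕ.+ x ℕ.* M) % M ≡⟨ cong (_% M) eq ⟩
    (a′ ℕ.+ x′ ℕ.* M) % M ≡⟨ [m+kn]%n≡m%n a′ x′ M ⟩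
    a′ % M           ≡⟨ m<n⇒m%n≡m a′<M ⟩
    a′               ∎

Unique-length : ∀ {A : Set} {xs ys : List A} → Unique xs → Unique ys →
                (∀ {x} → x ∈ xs → x ∈ ys) → (∀ {x} → x ∈ ys → x ∈ xs) → length xs ≡ length ys
Unique-length uxs uys xs⊆ys ys⊆xs = ↭-length (∼bag⇒↭ (unique∧set⇒bag uxs uys (mk⇔ xs⊆ys ys⊆xs)))

-- A + B √D > 0, stated without square roots
SqrtPositive : ℕ → ℤ → ℤ → Set
SqrtPositive D A B = ((0ℤ ℤ.< A) ⊎ (0ℤ ℤ.< B))
                   × (B ℤ.< 0ℤ → + D ℤ.* (B ℤ.* B) ℤ.< A ℤ.* A)
                   × (A ℤ.< 0ℤ → 0ℤ ℤ.< B → A ℤ.* A ℤ.< + D ℤ.* (B ℤ.* B))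

module RationalEmbedding where

  open import Data.Rational as Q using (ℚ; 0ℚ; 1ℚ)
  import Data.Rational.Properties as QP
  open import Data.Rational.Unnormalised as U using (ℚᵘ; mkℚᵘ; _≃_; 0ℚᵘ; 1ℚᵘ)
  import Data.Rational.Unnormalised.Properties as UP
  open import Data.Integer as ℤ using (ℤ; +_; +[1+_]; -[1+_])
  import Data.Integer.Properties as ℤP
  open import Data.Nat as ℕ using (ℕ; zero; suc)
  open import Data.Empty using (⊥-elim)
  open import Relation.Binary.PropositionalEquality

  toℚ : ℚᵘ → ℚ
  toℚ = Q.fromℚᵘ

  toℚ-cong : ∀ {a b} → a ≃ b → toℚ a ≡ toℚ b
  toℚ-cong = QP.fromℚᵘ-cong

  toℚ-injective : ∀ {a b} → toℚ a ≡ toℚ b → a ≃ b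
  toℚ-injective = QP.fromℚᵘ-injective

  private
    back : ∀ a → a ≃ Q.toℚᵘ (toℚ a)
    back a = UP.≃-sym (QP.toℚᵘ-fromℚᵘ a)

  toℚ-+ : ∀ a b → toℚ (a U.+ b) ≡ toℚ a Q.+ toℚ b
  toℚ-+ a b = trans (toℚ-cong (UP.+-cong (back a) (back b)))
           (trans (toℚ-cong (UP.≃-sym (QP.toℚᵘ-homo-+ (toℚ a) (toℚ b)))) (QP.fromℚᵘ-toℚᵘ _))

  toℚ-* : ∀ a b → toℚ (a U.* b) ≡ toℚ a Q.* toℚ b
  toℚ-* a b = trans (toℚ-cong (UP.*-cong (back a) (back b)))
           (trans (toℚ-cong (UP.≃-sym (QP.toℚᵘ-homo-* (toℚ a) (toℚ b)))) (QP.fromℚᵘ-toℚᵘ _))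

  toℚ-neg : ∀ a → toℚ (U.- a) ≡ Q.- toℚ a
  toℚ-neg a = trans (toℚ-cong (UP.-‿cong (back a)))
           (trans (toℚ-cong (UP.≃-sym (QP.toℚᵘ-homo‿- (toℚ a)))) (QP.fromℚᵘ-toℚᵘ _))

  ι : ℤ → ℚᵘ
  ι z = mkℚᵘ z 0

  ⌜_⌝ : ℤ → ℚ
  ⌜ z ⌝ = toℚ (ι z)

  ι-+ : ∀ a b → ι (a ℤ.+ b) ≃ ι a U.+ ι b
  ι-+ a b = U.*≡* (cong₂ (λ x y → (x ℤ.+ y) ℤ.* + 1) (sym (ℤP.*-identityʳ a)) (sym (ℤP.*-identityʳ b)))

  ι-* : ∀ a b → ι (a ℤ.* b) ≃ ι a U.* ι b
  ι-* a b = U.*≡* refl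

  ι-≤ : ∀ {a b} → a ℤ.≤ b → ι a U.≤ ι b
  ι-≤ {a} {b} h = U.*≤* (subst₂ ℤ._≤_ (sym (ℤP.*-identityʳ a)) (sym (ℤP.*-identityʳ b)) h)

  ι-≤⁻ : ∀ {a b} → ι a U.≤ ι b → a ℤ.≤ b
  ι-≤⁻ {a} {b} (U.*≤* h) = subst₂ ℤ._≤_ (ℤP.*-identityʳ a) (ℤP.*-identityʳ b) h

  ι-< : ∀ {a b} → a ℤ.< b → ι a U.< ι b
  ι-< {a} {b} h = U.*<* (subst₂ ℤ._<_ (sym (ℤP.*-identityʳ a)) (sym (ℤP.*-identityʳ b)) h)

  ι-<⁻ : ∀ {a b} → ι a U.< ι b → a ℤ.< b
  ι-<⁻ {a} {b} (U.*<* h) = subst₂ ℤ._<_ (ℤP.*-identityʳ a) (ℤP.*-identityʳ b) h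

  ⌜⌝-+ : ∀ a b → ⌜ a ℤ.+ b ⌝ ≡ ⌜ a ⌝ Q.+ ⌜ b ⌝
  ⌜⌝-+ a b = trans (toℚ-cong (ι-+ a b)) (toℚ-+ (ι a) (ι b))

  ⌜⌝-* : ∀ a b → ⌜ a ℤ.* b ⌝ ≡ ⌜ a ⌝ Q.* ⌜ b ⌝
  ⌜⌝-* a b = trans (toℚ-cong (ι-* a b)) (toℚ-* (ι a) (ι b))

  ⌜⌝-neg : ∀ a → ⌜ ℤ.- a ⌝ ≡ Q.- ⌜ a ⌝
  ⌜⌝-neg a = toℚ-neg (ι a)

  ⌜⌝-sub : ∀ a b → ⌜ a ℤ.- b ⌝ ≡ ⌜ a ⌝ Q.- ⌜ b ⌝
  ⌜⌝-sub a b = trans (⌜⌝-+ a (ℤ.- b)) (cong (⌜ a ⌝ Q.+_) (⌜⌝-neg b))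

  ⌜+⌝≢0 : ∀ {n} → 1 ℕ.≤ n → ⌜ + n ⌝ ≢ 0ℚ
  ⌜+⌝≢0 {suc n} _ e with toℚ-injective {ι (+ suc n)} {0ℚᵘ} e
  ... | U.*≡* ()

  ½/ : ℕ → ℚᵘ
  ½/ n = mkℚᵘ (+ 1) 1 U.* recipQ (ι (+ n))

  ½/-positive : ∀ {n} → 1 ℕ.≤ n → U.Positive (½/ n)
  ½/-positive {suc n} _ = _

  recipQ-inverseˡ : ∀ q → toℚ q ≢ 0ℚ → recipQ q U.* q ≃ 1ℚᵘ
  recipQ-inverseˡ (mkℚᵘ (+ zero) k) q≢0 = ⊥-elim (q≢0 (toℚ-cong {mkℚᵘ (+ zero) k} {0ℚᵘ} (U.*≡* refl)))
  recipQ-inverseˡ q@(mkℚᵘ +[1+ n ] k) _ = UP.*-inverseˡ q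
  recipQ-inverseˡ q@(mkℚᵘ -[1+ n ] k) _ = UP.*-inverseˡ q

  toℚ-recipQ : ∀ q → toℚ q ≢ 0ℚ → toℚ (recipQ q) Q.* toℚ q ≡ 1ℚ
  toℚ-recipQ q q≢0 = trans (sym (toℚ-* (recipQ q) q)) (toℚ-cong (recipQ-inverseˡ q q≢0))

module QuadraticField where

  open import Defs
  open RationalEmbedding
  open import Data.Rational as Q using (ℚ)
  import Data.Rational.Properties as QP
  open import Data.Rational.Unnormalised as U using (ℚᵘ; _≃_)
  import Data.Rational.Unnormalised.Properties as UP
  open import Data.Integer as ℤ using (+_)
  open import Data.Product using (_×_; _,_; proj₁; proj₂)
  open import Data.Sum using (inj₁; inj₂)
  open import Relation.Binary.PropositionalEquality

  ℚ² : Set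
  ℚ² = ℚ × ℚ

  ⟦_⟧ : QSqrt → ℚ²
  ⟦ x ⟧ = toℚ (re x) , toℚ (ir x)

  add2 : ℚ² → ℚ² → ℚ²
  add2 (a , b) (c , e) = a Q.+ c , b Q.+ e

  neg2 : ℚ² → ℚ²
  neg2 (a , b) = Q.- a , Q.- b

  mul2 : ℚ → ℚ² → ℚ² → ℚ²
  mul2 D (a , b) (c , e) = a Q.* c Q.+ D Q.* (b Q.* e) , a Q.* e Q.+ b Q.* c

  inv2 : ℚ → ℚ² → ℚ²
  inv2 r (a , b) = a Q.* r , Q.- (b Q.* r)

  norm2 : ℚ → ℚ² → ℚ
  norm2 D (a , b) = a Q.* a Q.- D Q.* (b Q.* b)

  normᵘ : ℕ → QSqrt → ℚᵘ
  normᵘ D x = re x U.* re x U.- (+ D U./ 1) U.* (ir x U.* ir x)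

  ⟦⊕⟧ : ∀ x y → ⟦ x ⊕ y ⟧ ≡ add2 ⟦ x ⟧ ⟦ y ⟧
  ⟦⊕⟧ x y = cong₂ _,_ (toℚ-+ (re x) (re y)) (toℚ-+ (ir x) (ir y))

  ⟦⊖⟧ : ∀ x → ⟦ ⊖ x ⟧ ≡ neg2 ⟦ x ⟧
  ⟦⊖⟧ x = cong₂ _,_ (toℚ-neg (re x)) (toℚ-neg (ir x))

  ⟦⊝⟧ : ∀ x y → ⟦ x ⊝ y ⟧ ≡ add2 ⟦ x ⟧ (neg2 ⟦ y ⟧)
  ⟦⊝⟧ x y = trans (⟦⊕⟧ x (⊖ y)) (cong (add2 ⟦ x ⟧) (⟦⊖⟧ y))

  ⟦mul⟧ : ∀ D x y → ⟦ mul D x y ⟧ ≡ mul2 (⌜ + D ⌝) ⟦ x ⟧ ⟦ y ⟧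
  ⟦mul⟧ D x y = cong₂ _,_
    (trans (toℚ-+ (re x U.* re y) (ι (+ D) U.* (ir x U.* ir y)))
           (cong₂ Q._+_ (toℚ-* (re x) (re y))
                        (trans (toℚ-* (ι (+ D)) (ir x U.* ir y)) (cong (⌜ + D ⌝ Q.*_) (toℚ-* (ir x) (ir y))))))
    (trans (toℚ-+ (re x U.* ir y) (ir x U.* re y)) (cong₂ Q._+_ (toℚ-* (re x) (ir y)) (toℚ-* (ir x) (re y))))

  ⟦norm⟧ : ∀ D x → toℚ (normᵘ D x) ≡ norm2 (⌜ + D ⌝) ⟦ x ⟧
  ⟦norm⟧ D x = trans (toℚ-+ (re x U.* re x) (U.- (ι (+ D) U.* (ir x U.* ir x))))
    (cong₂ Q._+_ (toℚ-* (re x) (re x))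
                 (trans (toℚ-neg (ι (+ D) U.* (ir x U.* ir x)))
                        (cong Q.-_ (trans (toℚ-* (ι (+ D)) (ir x U.* ir x)) (cong (⌜ + D ⌝ Q.*_) (toℚ-* (ir x) (ir x)))))))

  ⟦inv⟧ : ∀ D x → ⟦ inv D x ⟧ ≡ inv2 (toℚ (recipQ (normᵘ D x))) ⟦ x ⟧
  ⟦inv⟧ D x = cong₂ _,_ (toℚ-* (re x) (recipQ (normᵘ D x)))
                        (trans (toℚ-neg (ir x U.* recipQ (normᵘ D x))) (cong Q.-_ (toℚ-* (ir x) (recipQ (normᵘ D x)))))

  _≋_ : QSqrt → QSqrt → Set
  x ≋ y = (re x ≃ re y) × (ir x ≃ ir y)

  ⟦⟧-injective : ∀ {x y} → ⟦ x ⟧ ≡ ⟦ y ⟧ → x ≋ y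
  ⟦⟧-injective e = toℚ-injective (cong proj₁ e) , toℚ-injective (cong proj₂ e)

  ≤-resp₂-≃ : ∀ {a a′ b b′} → a ≃ a′ → b ≃ b′ → a U.≤ b → a′ U.≤ b′
  ≤-resp₂-≃ ea eb h = UP.≤-respʳ-≃ eb (UP.≤-respˡ-≃ ea h)

  NonNeg-resp : ∀ D {x y} → x ≋ y → NonNeg D x → NonNeg D y
  NonNeg-resp D {x} {y} (er , ei) (inj₁ (a , b)) = inj₁ (UP.≤-respʳ-≃ er a , UP.≤-respʳ-≃ ei b)
  NonNeg-resp D {x} {y} (er , ei) (inj₂ (inj₁ (a , b , c))) =
    inj₂ (inj₁ (UP.≤-respʳ-≃ er a , UP.<-respˡ-≃ ei b , ≤-resp₂-≃ (UP.*-congˡ {+ D U./ 1} (UP.*-cong ei ei)) (UP.*-cong er er) c))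
  NonNeg-resp D {x} {y} (er , ei) (inj₂ (inj₂ (a , b , c))) =
    inj₂ (inj₂ (UP.<-respˡ-≃ er a , UP.≤-respʳ-≃ ei b , ≤-resp₂-≃ (UP.*-cong er er) (UP.*-congˡ {+ D U./ 1} (UP.*-cong ei ei)) c))


module QuadraticSigns (c : ℚᵘ) .{{_ : ℚᵘ.Positive c}} (Dn : ℕ) where

  open RationalEmbedding
  open import Data.Rational.Unnormalised.Solver using (module +-*-Solver)
  open +-*-Solver using (solve; _:=_; _:*_)
  open QuadraticField using (≤-resp₂-≃)
  open import Data.Rational.Unnormalised as U using (ℚᵘ; _≃_; 0ℚᵘ; Positive; NonNegative)
  import Data.Rational.Unnormalised.Properties as UP
  open import Data.Integer as ℤ using (ℤ; +_; 0ℤ)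
  import Data.Integer.Properties as ℤP
  open import Data.Nat using (zero)
  open import Data.Product using (_,_)
  open import Data.Sum using (_⊎_; inj₁; inj₂)
  open import Data.Empty using (⊥; ⊥-elim)
  open import Relation.Binary.PropositionalEquality
  open import Relation.Binary.Definitions using (tri<; tri≈; tri>)
  open IntegerSigns using (0<*)

  private
    instance
      nnc : NonNegative c
      nnc = UP.pos⇒nonNeg c

    scale-≤ : ∀ {a b} → a ℤ.≤ b → ι a U.* c U.≤ ι b U.* c
    scale-≤ h = UP.*-monoˡ-≤-nonNeg c (ι-≤ h)

    scale-≤⁻ : ∀ {a b} → ι a U.* c U.≤ ι b U.* c → a ℤ.≤ b
    scale-≤⁻ h = ι-≤⁻ (UP.*-cancelʳ-≤-pos c h)

    scale-< : ∀ {a b} → a ℤ.< b → ι a U.* c U.< ι b U.* c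
    scale-< h = UP.*-monoˡ-<-pos c (ι-< h)

    scale-<⁻ : ∀ {a b} → ι a U.* c U.< ι b U.* c → a ℤ.< b
    scale-<⁻ h = ι-<⁻ (UP.*-cancelʳ-<-nonNeg c h)

    scale-0 : ι 0ℤ U.* c ≃ 0ℚᵘ
    scale-0 = UP.*-zeroˡ c

    0≤scale : ∀ {a} → 0ℤ ℤ.≤ a → 0ℚᵘ U.≤ ι a U.* c
    0≤scale h = UP.≤-respˡ-≃ scale-0 (scale-≤ h)

    0≤scale⁻ : ∀ {a} → 0ℚᵘ U.≤ ι a U.* c → 0ℤ ℤ.≤ a
    0≤scale⁻ h = scale-≤⁻ (UP.≤-respˡ-≃ (UP.≃-sym scale-0) h)

    scale<0 : ∀ {a} → a ℤ.< 0ℤ → ι a U.* c U.< 0ℚᵘ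
    scale<0 h = UP.<-respʳ-≃ scale-0 (scale-< h)

    scale<0⁻ : ∀ {a} → ι a U.* c U.< 0ℚᵘ → a ℤ.< 0ℤ
    scale<0⁻ h = scale-<⁻ (UP.<-respʳ-≃ (UP.≃-sym scale-0) h)

    cc : ℚᵘ
    cc = c U.* c
    instance
      pcc : Positive cc
      pcc = UP.pos*pos⇒pos c c
      nncc : NonNegative cc
      nncc = UP.pos⇒nonNeg cc

    scale² : ∀ a → (ι a U.* c) U.* (ι a U.* c) ≃ ι (a ℤ.* a) U.* cc
    scale² a = UP.≃-trans (lemma (ι a) c) (UP.*-congʳ {cc} (UP.≃-sym (ι-* a a)))
      where
      lemma : ∀ x c → (x U.* c) U.* (x U.* c) ≃ (x U.* x) U.* (c U.* c)
      lemma = solve 2 (λ x c → (x :* c) :* (x :* c) := (x :* x) :* (c :* c)) UP.≃-refl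

    D*scale² : ∀ b → (+ Dn U./ 1) U.* ((ι b U.* c) U.* (ι b U.* c)) ≃ ι (+ Dn ℤ.* (b ℤ.* b)) U.* cc
    D*scale² b = UP.≃-trans (lemma (ι (+ Dn)) (ι b) c)
                   (UP.*-congʳ {cc} (UP.≃-sym (UP.≃-trans (ι-* (+ Dn) (b ℤ.* b)) (UP.*-congˡ {ι (+ Dn)} (ι-* b b)))))
      where
      lemma : ∀ D x c → D U.* ((x U.* c) U.* (x U.* c)) ≃ (D U.* (x U.* x)) U.* (c U.* c)
      lemma = solve 3 (λ D x c → D :* ((x :* c) :* (x :* c)) := (D :* (x :* x)) :* (c :* c)) UP.≃-refl

    scale²-≤ : ∀ {a b} → a ℤ.≤ b → ι a U.* cc U.≤ ι b U.* cc
    scale²-≤ h = UP.*-monoˡ-≤-nonNeg cc (ι-≤ h)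

    scale²-≤⁻ : ∀ {a b} → ι a U.* cc U.≤ ι b U.* cc → a ℤ.≤ b
    scale²-≤⁻ h = ι-≤⁻ (UP.*-cancelʳ-≤-pos cc h)

  scaled : ℤ → ℤ → QSqrt
  scaled A B = ⟨ ι A U.* c , ι B U.* c ⟩

  SqrtPositive⇒NonNeg : ∀ A B → SqrtPositive Dn A B → NonNeg Dn (scaled A B)
  SqrtPositive⇒NonNeg A B (sg , h2 , h3) with ℤP.<-cmp A 0ℤ | ℤP.<-cmp B 0ℤ
  ... | tri< a<0 _ _ | tri< b<0 _ _ = ⊥-elim (case sg)
    where case : (0ℤ ℤ.< A) ⊎ (0ℤ ℤ.< B) → ⊥
          case (inj₁ x) = ℤP.<-asym x a<0
          case (inj₂ x) = ℤP.<-asym x b<0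
  ... | tri< a<0 _ _ | tri≈ _ b=0 _ = ⊥-elim (case sg)
    where case : (0ℤ ℤ.< A) ⊎ (0ℤ ℤ.< B) → ⊥
          case (inj₁ x) = ℤP.<-asym x a<0
          case (inj₂ x) = ℤP.<-irrefl (sym b=0) x
  ... | tri< a<0 _ _ | tri> _ _ b>0 = inj₂ (inj₂ (scale<0 a<0 , 0≤scale (ℤP.<⇒≤ b>0) ,
          ≤-resp₂-≃ (UP.≃-sym (scale² A)) (UP.≃-sym (D*scale² B)) (scale²-≤ (ℤP.<⇒≤ (h3 a<0 b>0)))))
  ... | tri≈ _ a=0 _ | tri< b<0 _ _ = inj₂ (inj₁ (0≤scale (ℤP.≤-reflexive (sym a=0)) , scale<0 b<0 ,
          ≤-resp₂-≃ (UP.≃-sym (D*scale² B)) (UP.≃-sym (scale² A)) (scale²-≤ (ℤP.<⇒≤ (h2 b<0)))))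
  ... | tri> _ _ a>0 | tri< b<0 _ _ = inj₂ (inj₁ (0≤scale (ℤP.<⇒≤ a>0) , scale<0 b<0 ,
          ≤-resp₂-≃ (UP.≃-sym (D*scale² B)) (UP.≃-sym (scale² A)) (scale²-≤ (ℤP.<⇒≤ (h2 b<0)))))
  ... | tri≈ _ a=0 _ | tri≈ _ b=0 _ = inj₁ (0≤scale (ℤP.≤-reflexive (sym a=0)) , 0≤scale (ℤP.≤-reflexive (sym b=0)))
  ... | tri≈ _ a=0 _ | tri> _ _ b>0 = inj₁ (0≤scale (ℤP.≤-reflexive (sym a=0)) , 0≤scale (ℤP.<⇒≤ b>0))
  ... | tri> _ _ a>0 | tri≈ _ b=0 _ = inj₁ (0≤scale (ℤP.<⇒≤ a>0) , 0≤scale (ℤP.≤-reflexive (sym b=0)))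
  ... | tri> _ _ a>0 | tri> _ _ b>0 = inj₁ (0≤scale (ℤP.<⇒≤ a>0) , 0≤scale (ℤP.<⇒≤ b>0))

  private
    -a*-a≡a*a : ∀ a → ℤ.- a ℤ.* ℤ.- a ≡ a ℤ.* a
    -a*-a≡a*a a = trans (sym (ℤP.neg-distribˡ-* a (ℤ.- a))) (trans (cong ℤ.-_ (sym (ℤP.neg-distribʳ-* a a))) (ℤP.neg-involutive (a ℤ.* a)))

    neg≤0 : ∀ {a} → 0ℤ ℤ.≤ ℤ.- a → a ℤ.≤ 0ℤ
    neg≤0 {a} h = subst (ℤ._≤ 0ℤ) (ℤP.neg-involutive a) (ℤP.neg-mono-≤ h)

    neg<0 : ∀ {a} → ℤ.- a ℤ.< 0ℤ → 0ℤ ℤ.< a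
    neg<0 {a} h = subst (0ℤ ℤ.<_) (ℤP.neg-involutive a) (ℤP.neg-mono-< h)

    0<sq : ∀ {a} → 0ℤ ℤ.< a → 0ℤ ℤ.< a ℤ.* a
    0<sq {ℤ.+[1+ n ]} _ = ℤ.+<+ (ℕ.s≤s ℕ.z≤n)
    0<sq {+ zero} (ℤ.+<+ ())

  SqrtPositive⇒¬NonNeg-neg : ∀ A B → 1 ℕ.≤ Dn → SqrtPositive Dn A B → NonNeg Dn (scaled (ℤ.- A) (ℤ.- B)) → ⊥
  SqrtPositive⇒¬NonNeg-neg A B hD (sg , h2 , h3) (inj₁ (x , y)) = case sg
    where case : (0ℤ ℤ.< A) ⊎ (0ℤ ℤ.< B) → ⊥
          case (inj₁ p) = ℤP.<⇒≱ p (neg≤0 (0≤scale⁻ x))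
          case (inj₂ p) = ℤP.<⇒≱ p (neg≤0 (0≤scale⁻ y))
  SqrtPositive⇒¬NonNeg-neg A B hD (sg , h2 , h3) (inj₂ (inj₁ (x , y , z))) with ℤP.<-cmp A 0ℤ
  ... | tri< a<0 _ _ = ℤP.<⇒≱ (h3 a<0 b>0) (subst₂ ℤ._≤_ (cong (λ t → + Dn ℤ.* t) (-a*-a≡a*a B)) (-a*-a≡a*a A) w)
    where
    b>0 : 0ℤ ℤ.< B
    b>0 = neg<0 (scale<0⁻ y)
    w : + Dn ℤ.* (ℤ.- B ℤ.* ℤ.- B) ℤ.≤ ℤ.- A ℤ.* ℤ.- A
    w = scale²-≤⁻ (≤-resp₂-≃ (D*scale² (ℤ.- B)) (scale² (ℤ.- A)) z)
  ... | tri≈ _ a=0 _ = ℤP.<⇒≱ (0<* (ℤ.+<+ hD) (0<sq b>0))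
                         (subst (ℤ._≤ 0ℤ) (cong (λ t → + Dn ℤ.* t) (-a*-a≡a*a B)) (subst (λ t → + Dn ℤ.* (ℤ.- B ℤ.* ℤ.- B) ℤ.≤ t) e w))
    where
    b>0 : 0ℤ ℤ.< B
    b>0 = neg<0 (scale<0⁻ y)
    w : + Dn ℤ.* (ℤ.- B ℤ.* ℤ.- B) ℤ.≤ ℤ.- A ℤ.* ℤ.- A
    w = scale²-≤⁻ (≤-resp₂-≃ (D*scale² (ℤ.- B)) (scale² (ℤ.- A)) z)
    e : ℤ.- A ℤ.* ℤ.- A ≡ 0ℤ
    e = trans (-a*-a≡a*a A) (cong (λ t → t ℤ.* t) a=0)
  ... | tri> _ _ a>0 = ℤP.<⇒≱ a>0 (neg≤0 (0≤scale⁻ x))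
  SqrtPositive⇒¬NonNeg-neg A B hD (sg , h2 , h3) (inj₂ (inj₂ (x , y , z))) with ℤP.<-cmp B 0ℤ
  ... | tri< b<0 _ _ = ℤP.<⇒≱ (h2 b<0) (subst₂ ℤ._≤_ (-a*-a≡a*a A) (cong (λ t → + Dn ℤ.* t) (-a*-a≡a*a B)) w)
    where
    w : ℤ.- A ℤ.* ℤ.- A ℤ.≤ + Dn ℤ.* (ℤ.- B ℤ.* ℤ.- B)
    w = scale²-≤⁻ (≤-resp₂-≃ (scale² (ℤ.- A)) (D*scale² (ℤ.- B)) z)
  ... | tri≈ _ b=0 _ = ℤP.<⇒≱ (0<sq a>0) (subst (ℤ._≤ 0ℤ) (-a*-a≡a*a A) (subst (λ t → ℤ.- A ℤ.* ℤ.- A ℤ.≤ t) e w))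
    where
    a>0 : 0ℤ ℤ.< A
    a>0 = neg<0 (scale<0⁻ x)
    w : ℤ.- A ℤ.* ℤ.- A ℤ.≤ + Dn ℤ.* (ℤ.- B ℤ.* ℤ.- B)
    w = scale²-≤⁻ (≤-resp₂-≃ (scale² (ℤ.- A)) (D*scale² (ℤ.- B)) z)
    e : + Dn ℤ.* (ℤ.- B ℤ.* ℤ.- B) ≡ 0ℤ
    e = trans (cong (λ t → + Dn ℤ.* t) (trans (-a*-a≡a*a B) (cong (λ t → t ℤ.* t) b=0))) (ℤP.*-zeroʳ (+ Dn))
  ... | tri> _ _ b>0 = ℤP.<⇒≱ b>0 (neg≤0 (0≤scale⁻ y))


-- αPos p q encodes p + qα > 0 by the positivity of p Dₙ + q Dₙ₊₁ and
-- p Dₙ₊₁ + q Dₙ₊₂ for some n; as the ratios Dₙ₊₁/Dₙ alternate around α,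
-- this is equivalent and avoids real numbers.
module AlphaPositivity (d : ℕ) where

  open import Data.Nat using (zero; suc; z≤n; s≤s)
  open import Data.Integer using (ℤ; +_; +[1+_]; -[1+_]; _+_; _*_; -_; _-_; 0ℤ; +<+; -≤+)
  import Data.Integer as ℤ
  import Data.Integer.Properties as ℤP
  open import Data.Integer.Tactic.RingSolver using (solve-∀)
  open import Data.Product using (Σ; _×_; _,_; proj₁; proj₂)
  open import Data.Empty using (⊥-elim)
  open import Relation.Nullary using (¬_)
  open import Relation.Binary.PropositionalEquality
  open IntegerSigns

  opaque
    Dᶻ : ℕ → ℤ
    Dᶻ n = + Dseq d n

    lin : ℤ → ℤ → ℕ → ℤ
    lin p q n = p * Dᶻ n + q * Dᶻ (suc n)

  opaque
    unfolding lin

    Dᶻ-def : ∀ n → Dᶻ n ≡ + Dseq d n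
    Dᶻ-def n = refl

    Dᶻ-rec : ∀ n → Dᶻ (suc (suc n)) ≡ + d * Dᶻ (suc n) + Dᶻ n
    Dᶻ-rec n = trans (ℤP.pos-+ (d ℕ.* Dseq d (suc n)) (Dseq d n))
                     (cong (_+ Dᶻ n) (ℤP.pos-* d (Dseq d (suc n))))

    lin-def : ∀ p q n → lin p q n ≡ p * Dᶻ n + q * Dᶻ (suc n)
    lin-def p q n = refl

    lin-rec : ∀ p q n → lin p q (suc (suc n)) ≡ + d * lin p q (suc n) + lin p q n
    lin-rec p q n = begin
      p * Dᶻ (suc (suc n)) + q * Dᶻ (suc (suc (suc n)))
        ≡⟨ cong₂ (λ x y → p * x + q * y) (Dᶻ-rec n)
                 (trans (Dᶻ-rec (suc n)) (cong (λ z → + d * z + Dᶻ (suc n)) (Dᶻ-rec n))) ⟩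
      p * (+ d * Dᶻ (suc n) + Dᶻ n) + q * (+ d * (+ d * Dᶻ (suc n) + Dᶻ n) + Dᶻ (suc n))
        ≡⟨ lemma p q (+ d) (Dᶻ n) (Dᶻ (suc n)) ⟩
      + d * (p * Dᶻ (suc n) + q * (+ d * Dᶻ (suc n) + Dᶻ n)) + lin p q n
        ≡⟨ cong (λ z → + d * (p * Dᶻ (suc n) + q * z) + lin p q n) (sym (Dᶻ-rec n)) ⟩
      + d * lin p q (suc n) + lin p q n ∎
      where
      open ≡-Reasoning
      lemma : ∀ p q d a b → p * (d * b + a) + q * (d * (d * b + a) + b) ≡ d * (p * b + q * (d * b + a)) + (p * a + q * b)
      lemma = solve-∀

    -- α (p + qα) = q + (p + dq) α, as α² = dα + 1
    lin-*α : ∀ p q n → lin q (p + + d * q) n ≡ lin p q (suc n)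
    lin-*α p q n = trans (lemma p q (+ d) (Dᶻ n) (Dᶻ (suc n))) (cong (λ z → p * Dᶻ (suc n) + q * z) (sym (Dᶻ-rec n)))
      where
      lemma : ∀ p q d a b → q * a + (p + d * q) * b ≡ p * b + q * (d * b + a)
      lemma = solve-∀

    lin-+ : ∀ p q p′ q′ n → lin (p + p′) (q + q′) n ≡ lin p q n + lin p′ q′ n
    lin-+ p q p′ q′ n = lemma p q p′ q′ (Dᶻ n) (Dᶻ (suc n))
      where
      lemma : ∀ p q p′ q′ a b → (p + p′) * a + (q + q′) * b ≡ (p * a + q * b) + (p′ * a + q′ * b)
      lemma = solve-∀

    lin-nonNeg : ∀ {a b} n → 0ℤ ℤ.≤ a → 0ℤ ℤ.≤ b → 0ℤ ℤ.≤ lin a b n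
    lin-nonNeg n ha hb = 0≤+ (0≤* ha (0≤pos _)) (0≤* hb (0≤pos _))

  PositiveAt : ℤ → ℤ → ℕ → Set
  PositiveAt p q n = (0ℤ ℤ.< lin p q n) × (0ℤ ℤ.< lin p q (suc n))

  αPos : ℤ → ℤ → Set
  αPos p q = Σ ℕ (PositiveAt p q)

  PositiveAt-suc : ∀ {p q n} → PositiveAt p q n → PositiveAt p q (suc n)
  PositiveAt-suc {p} {q} {n} (a , b) =
    b , subst (0ℤ ℤ.<_) (sym (lin-rec p q n)) (0≤<+ (0≤* (0≤pos d) (ℤP.<⇒≤ b)) a)

  PositiveAt-+ : ∀ {p q n} k → PositiveAt p q n → PositiveAt p q (k ℕ.+ n)
  PositiveAt-+ zero x = x
  PositiveAt-+ (suc k) x = PositiveAt-suc (PositiveAt-+ k x)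

  αPos-cong : ∀ {p q p′ q′} → αPos p q → p ≡ p′ → q ≡ q′ → αPos p′ q′
  αPos-cong x refl refl = x

  αPos-/α : ∀ {p q} → αPos q (p + + d * q) → αPos p q
  αPos-/α {p} {q} (n , a , b) =
    suc n , subst (0ℤ ℤ.<_) (lin-*α p q n) a , subst (0ℤ ℤ.<_) (lin-*α p q (suc n)) b

  αPos-+ : ∀ {p q p′ q′} → αPos p q → αPos p′ q′ → αPos (p + p′) (q + q′)
  αPos-+ {p} {q} {p′} {q′} (n , x) (n′ , y) =
    n′ ℕ.+ n ,
    subst (0ℤ ℤ.<_) (sym (lin-+ p q p′ q′ (n′ ℕ.+ n))) (ℤP.+-mono-< (proj₁ x′) (proj₁ y′)) ,
    subst (0ℤ ℤ.<_) (sym (lin-+ p q p′ q′ (suc (n′ ℕ.+ n)))) (ℤP.+-mono-< (proj₂ x′) (proj₂ y′))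
    where
    x′ : PositiveAt p q (n′ ℕ.+ n)
    x′ = PositiveAt-+ n′ x
    y′ : PositiveAt p′ q′ (n′ ℕ.+ n)
    y′ = subst (PositiveAt p′ q′) (ℕP.+-comm n n′) (PositiveAt-+ n y)

  αPos-+nonNeg : ∀ {p q a b} → αPos p q → 0ℤ ℤ.≤ a → 0ℤ ℤ.≤ b → αPos (p + a) (q + b)
  αPos-+nonNeg {p} {q} {a} {b} (n , x , y) ha hb =
    n , shift n x , shift (suc n) y
    where
    shift : ∀ k → 0ℤ ℤ.< lin p q k → 0ℤ ℤ.< lin (p + a) (q + b) k
    shift k h = subst (0ℤ ℤ.<_) (sym (lin-+ p q a b k)) (0<+ h (lin-nonNeg k ha hb))

  -- (p + qα)(1 + α⁻¹) = (p + q - dp) + (q + p) α, as α⁻¹ = α - d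
  αPos-*[1+α⁻¹] : ∀ {p q} → αPos p q → αPos (p + (q - + d * p)) (q + p)
  αPos-*[1+α⁻¹] {p} {q} h = αPos-+ h (αPos-/α (αPos-cong h refl (lemma p q (+ d))))
    where
    lemma : ∀ p q d → q ≡ (q - d * p) + d * p
    lemma = solve-∀

  Dᶻ-suc-pos : 1 ℕ.≤ d → ∀ k → 0ℤ ℤ.< Dᶻ (suc k)
  Dᶻ-suc-pos h k = subst (0ℤ ℤ.<_) (sym (Dᶻ-def (suc k))) (+<+ (Dseq-suc-pos h k))

  α-d>0 : 1 ℕ.≤ d → αPos (- + d) (+ 1)
  α-d>0 h = 2 , subst (0ℤ ℤ.<_) (sym (eq 1)) (Dᶻ-suc-pos h 0) , subst (0ℤ ℤ.<_) (sym (eq 2)) (Dᶻ-suc-pos h 1)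
    where
    lemma : ∀ d a b → - d * b + + 1 * (d * b + a) ≡ a
    lemma = solve-∀
    eq : ∀ n → lin (- + d) (+ 1) (suc n) ≡ Dᶻ n
    eq n = trans (lin-def _ _ (suc n))
                 (trans (cong (λ z → - + d * Dᶻ (suc n) + + 1 * z) (Dᶻ-rec n)) (lemma (+ d) (Dᶻ n) (Dᶻ (suc n))))

  d+1-α>0 : 2 ℕ.≤ d → αPos (+ suc d) (- + 1)
  d+1-α>0 h = 1 , subst (0ℤ ℤ.<_) (sym (trans (eq 0) (cong₂ _-_ (Dᶻ-def 1) (Dᶻ-def 0)))) (+<+ (s≤s z≤n))
                , subst (0ℤ ℤ.<_) (sym (eq 1)) D₂-D₁>0
    where
    lemma : ∀ d a b → (+ 1 + d) * b + - + 1 * (d * b + a) ≡ b - a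
    lemma = solve-∀
    eq : ∀ n → lin (+ suc d) (- + 1) (suc n) ≡ Dᶻ (suc n) - Dᶻ n
    eq n = trans (lin-def _ _ (suc n))
                 (trans (cong (λ z → + suc d * Dᶻ (suc n) + - + 1 * z) (Dᶻ-rec n)) (lemma (+ d) (Dᶻ n) (Dᶻ (suc n))))
    D₂-D₁>0 : 0ℤ ℤ.< Dᶻ 2 - Dᶻ 1
    D₂-D₁>0 = subst₂ (λ a b → 0ℤ ℤ.< a - b)
                (sym (trans (Dᶻ-def 2) (cong +_ (trans (ℕP.+-identityʳ (d ℕ.* 1)) (ℕP.*-identityʳ d)))))
                (sym (Dᶻ-def 1)) (<⇒0<- (+<+ h))

  1>0 : 1 ℕ.≤ d → αPos (+ 1) 0ℤ
  1>0 h = 1 , subst (0ℤ ℤ.<_) (sym (eq 1)) (Dᶻ-suc-pos h 0) , subst (0ℤ ℤ.<_) (sym (eq 2)) (Dᶻ-suc-pos h 1)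
    where
    lemma : ∀ a b → + 1 * a + 0ℤ * b ≡ a
    lemma = solve-∀
    eq : ∀ n → lin (+ 1) 0ℤ n ≡ Dᶻ n
    eq n = trans (lin-def _ _ n) (lemma (Dᶻ n) (Dᶻ (suc n)))

  ¬0>0 : ¬ αPos 0ℤ 0ℤ
  ¬0>0 (n , x , _) = ℤP.<-irrefl refl (subst (0ℤ ℤ.<_) (trans (lin-def _ _ n) (lemma (Dᶻ n) (Dᶻ (suc n)))) x)
    where
    lemma : ∀ a b → 0ℤ * a + 0ℤ * b ≡ 0ℤ
    lemma = solve-∀

  αPos-integer : ∀ {c} → αPos c 0ℤ → 0ℤ ℤ.< c
  αPos-integer {+[1+ k ]} _ = +<+ (s≤s z≤n)
  αPos-integer {+ zero} x = ⊥-elim (¬0>0 x)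
  αPos-integer { -[1+ k ]} (n , x , _) = ⊥-elim (ℤP.<⇒≱ 0<cDₙ cDₙ≤0)
    where
    lemma : ∀ c a b → c * a + 0ℤ * b ≡ c * a
    lemma = solve-∀
    0<cDₙ : 0ℤ ℤ.< -[1+ k ] * Dᶻ n
    0<cDₙ = subst (0ℤ ℤ.<_) (trans (lin-def _ _ n) (lemma -[1+ k ] (Dᶻ n) (Dᶻ (suc n)))) x
    cDₙ≤0 : -[1+ k ] * Dᶻ n ℤ.≤ 0ℤ * Dᶻ n
    cDₙ≤0 = subst (λ z → -[1+ k ] * z ℤ.≤ 0ℤ * z) (sym (Dᶻ-def n)) (ℤP.*-monoʳ-≤-nonNeg (+ Dseq d n) (-≤+ {k} {0}))

module OstrowskiNumeration (d : ℕ) (2≤d : 2 ℕ.≤ d) where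

  open import Data.Nat using (zero; suc; _+_; _*_; _≤_; _<_; _∸_; z≤n; s≤s)
  import Data.Nat.DivMod as ℕDM
  open import Data.Nat.DivMod using (_/_; _%_)
  open import Data.Nat.Tactic.RingSolver using (solve-∀)
  open import Data.List using (List; []; _∷_; length; _++_; _∷ʳ_; [_])
  open import Data.List.Base using (initLast; _∷ʳ′_)
  import Data.List.Properties as LP
  open import Data.Product using (Σ; _×_; _,_; proj₁; proj₂)
  open import Data.Sum using (_⊎_; inj₁; inj₂)
  open import Data.Unit using (tt)
  open import Data.Empty using (⊥; ⊥-elim)
  open import Relation.Nullary using (yes; no)
  open import Relation.Binary.Definitions using (tri<; tri≈; tri>)
  open import Relation.Binary.PropositionalEquality hiding ([_])

  D : ℕ → ℕ
  D = Dseq d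

  1≤d : 1 ≤ d
  1≤d = ℕP.≤-trans (s≤s z≤n) 2≤d

  D-suc-pos : ∀ k → 1 ≤ D (suc k)
  D-suc-pos = Dseq-suc-pos 1≤d

  D-suc-nonZero : ∀ k → ℕ.NonZero (D (suc k))
  D-suc-nonZero k = ℕ.>-nonZero (D-suc-pos k)

  d*D≤D : ∀ k → d * D (suc k) ≤ D (suc (suc k))
  d*D≤D k = ℕP.m≤m+n _ _

  D₂≡d : D 2 ≡ d
  D₂≡d = trans (ℕP.+-identityʳ (d * 1)) (ℕP.*-identityʳ d)

  D-suc-< : ∀ k → D (suc k) < D (suc (suc k))
  D-suc-< zero = ℕP.≤-trans 2≤d (ℕP.≤-reflexive (sym D₂≡d))
  D-suc-< (suc k) = ℕP.<-≤-trans (ℕP.<-≤-trans (ℕP.m<m*n (D (suc (suc k))) d 2≤d) (ℕP.≤-reflexive (ℕP.*-comm (D (suc (suc k))) d)))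
                                 (ℕP.m≤m+n _ _)
    where instance _ = D-suc-nonZero (suc k)

  D-suc-mono-+ : ∀ i k → D (suc i) ≤ D (suc (k + i))
  D-suc-mono-+ i zero = ℕP.≤-refl
  D-suc-mono-+ i (suc k) = ℕP.≤-trans (D-suc-mono-+ i k) (ℕP.<⇒≤ (D-suc-< (k + i)))

  D-suc-mono : ∀ {i j} → i ≤ j → D (suc i) ≤ D (suc j)
  D-suc-mono {i} {j} h = subst (λ z → D (suc i) ≤ D (suc z)) (ℕP.m∸n+n≡m h) (D-suc-mono-+ i (j ∸ i))

  valueFrom-++ : ∀ j u v → valueFrom d j (u ++ v) ≡ valueFrom d j u + valueFrom d (j + length u) v
  valueFrom-++ j [] v = cong (λ z → valueFrom d z v) (sym (ℕP.+-identityʳ j))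
  valueFrom-++ j (x ∷ u) v =
    trans (cong (λ z → x * D j + z)
                (trans (valueFrom-++ (suc j) u v) (cong (λ z → valueFrom d (suc j) u + valueFrom d z v) (sym (ℕP.+-suc j (length u))))))
          (sym (ℕP.+-assoc (x * D j) _ _))

  value-∷ʳ : ∀ u x → value d (u ∷ʳ x) ≡ value d u + x * D (suc (length u))
  value-∷ʳ u x = trans (valueFrom-++ 1 u [ x ]) (cong (λ z → value d u + z) (ℕP.+-identityʳ _))

  valueFrom-rec : ∀ j u → valueFrom d (suc (suc j)) u ≡ d * valueFrom d (suc j) u + valueFrom d j u
  valueFrom-rec j [] = sym (trans (ℕP.+-identityʳ (d * 0)) (ℕP.*-zeroʳ d))
  valueFrom-rec j (x ∷ u) = trans (cong (λ z → x * (d * D (suc j) + D j) + z) (valueFrom-rec (suc j) u))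
     (lemma x d (D (suc j)) (D j) (valueFrom d (suc (suc j)) u) (valueFrom d (suc j) u))
    where
    lemma : ∀ x d a b c e → x * (d * a + b) + (d * c + e) ≡ d * (x * a + c) + (x * b + e)
    lemma = solve-∀

  EndsWith0From : ℕ → List ℕ → Set
  EndsWith0From p [] = p ≡ 0
  EndsWith0From p (y ∷ ys) = EndsWith0From y ys

  EndsWith0 : List ℕ → Set
  EndsWith0 [] = ⊥
  EndsWith0 (y ∷ ys) = EndsWith0From y ys

  length-∷ʳ : ∀ (u : List ℕ) x → length (u ∷ʳ x) ≡ suc (length u)
  length-∷ʳ u x = trans (LP.length-++ u) (ℕP.+-comm (length u) 1)

  OstTail-∷ʳ⁻ : ∀ p u x → OstTail d p (u ∷ʳ x) → OstTail d p u × x ≤ d × (x ≡ d → EndsWith0From p u)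
  OstTail-∷ʳ⁻ p [] x (h , c , _) = tt , h , c
  OstTail-∷ʳ⁻ p (y ∷ u) x (hy , cy , r) with OstTail-∷ʳ⁻ y u x r
  ... | (o , h , c) = (hy , cy , o) , h , c

  OstTail-∷ʳ : ∀ p u x → OstTail d p u → x ≤ d → (x ≡ d → EndsWith0From p u) → OstTail d p (u ∷ʳ x)
  OstTail-∷ʳ p [] x _ h c = h , c , tt
  OstTail-∷ʳ p (y ∷ u) x (hy , cy , o) h c = hy , cy , OstTail-∷ʳ y u x o h c

  EndsWith0⇒∷ʳ0 : ∀ y u → EndsWith0From y u → Σ (List ℕ) λ w → y ∷ u ≡ w ∷ʳ 0
  EndsWith0⇒∷ʳ0 y [] refl = [] , refl
  EndsWith0⇒∷ʳ0 y (z ∷ u) h with EndsWith0⇒∷ʳ0 z u h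
  ... | w , eq = y ∷ w , cong (y ∷_) eq

  ∷ʳ0-EndsWith0 : ∀ u → EndsWith0 (u ∷ʳ 0)
  ∷ʳ0-EndsWith0 [] = refl
  ∷ʳ0-EndsWith0 (y ∷ u) = go y u
    where
    go : ∀ y u → EndsWith0From y (u ∷ʳ 0)
    go y [] = refl
    go y (z ∷ u) = go z u

  IsOstrowski-∷ʳ⁻ : ∀ u x → IsOstrowski d (u ∷ʳ x) →
    IsOstrowski d u × x ≤ d × (u ≡ [] → x < d) × (x ≡ d → Σ (List ℕ) λ w → u ≡ w ∷ʳ 0)
  IsOstrowski-∷ʳ⁻ [] x (h , _) = tt , ℕP.<⇒≤ h , (λ _ → h) , (λ eq → ⊥-elim (ℕP.<-irrefl eq h))
  IsOstrowski-∷ʳ⁻ (y ∷ u) x (hy , r) with OstTail-∷ʳ⁻ y u x r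
  ... | (o , h , c) = (hy , o) , h , (λ ()) , (λ eq → EndsWith0⇒∷ʳ0 y u (c eq))

  IsOstrowski-∷ʳ : ∀ u x → IsOstrowski d u → x ≤ d → (u ≡ [] → x < d) → (x ≡ d → EndsWith0 u) → IsOstrowski d (u ∷ʳ x)
  IsOstrowski-∷ʳ [] x _ h h0 c = h0 refl , tt
  IsOstrowski-∷ʳ (y ∷ u) x (hy , o) h h0 c = hy , OstTail-∷ʳ y u x o h c

  OstTail-++⁻ˡ : ∀ p u v → OstTail d p (u ++ v) → OstTail d p u
  OstTail-++⁻ˡ p [] v _ = tt
  OstTail-++⁻ˡ p (y ∷ u) v (hy , cy , r) = hy , cy , OstTail-++⁻ˡ y u v r

  IsOstrowski-++⁻ˡ : ∀ u v → IsOstrowski d (u ++ v) → IsOstrowski d u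
  IsOstrowski-++⁻ˡ [] v _ = tt
  IsOstrowski-++⁻ˡ (y ∷ u) v (hy , r) = hy , OstTail-++⁻ˡ y u v r

  LastNonzero-∷ʳ⁻ : ∀ u x → LastNonzero (u ∷ʳ x) → x ≢ 0
  LastNonzero-∷ʳ⁻ [] x h = h
  LastNonzero-∷ʳ⁻ (y ∷ []) x h = h
  LastNonzero-∷ʳ⁻ (y ∷ z ∷ u) x h = LastNonzero-∷ʳ⁻ (z ∷ u) x h

  LastNonzero-∷ʳ : ∀ u x → x ≢ 0 → LastNonzero (u ∷ʳ x)
  LastNonzero-∷ʳ [] x h = h
  LastNonzero-∷ʳ (y ∷ []) x h = h
  LastNonzero-∷ʳ (y ∷ z ∷ u) x h = LastNonzero-∷ʳ (z ∷ u) x h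

  private
    value<D-fuel : ∀ k w → length w ≤ k → IsOstrowski d w → value d w < D (suc (length w))
    value<D-fuel k w |w|≤k valid with initLast w
    value<D-fuel k .[] _ _ | [] = s≤s z≤n
    value<D-fuel zero .(u ∷ʳ x) |w|≤0 _ | u ∷ʳ′ x = ⊥-elim (ℕP.n≮0 (subst (_≤ 0) (length-∷ʳ u x) |w|≤0))
    value<D-fuel (suc k) .(u ∷ʳ x) |w|≤1+k valid | u ∷ʳ′ x with IsOstrowski-∷ʳ⁻ u x valid | x ℕP.≟ d
    ... | u-valid , x≤d , _ , _ | no x≢d = begin-strict
      value d (u ∷ʳ x)                               ≡⟨ value-∷ʳ u x ⟩
      value d u + x * D (suc (length u))             <⟨ ℕP.+-monoˡ-< _ (value<D-fuel k u |u|≤k u-valid) ⟩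
      suc x * D (suc (length u))                     ≤⟨ ℕP.*-monoˡ-≤ _ (ℕP.≤∧≢⇒< x≤d x≢d) ⟩
      d * D (suc (length u))                         ≤⟨ d*D≤D (length u) ⟩
      D (suc (suc (length u)))                       ≡⟨ cong (λ l → D (suc l)) (sym (length-∷ʳ u x)) ⟩
      D (suc (length (u ∷ʳ x)))                      ∎
      where
      open ℕP.≤-Reasoning
      |u|≤k : length u ≤ k
      |u|≤k = ℕP.≤-pred (subst (_≤ suc k) (length-∷ʳ u x) |w|≤1+k)
    ... | u-valid , _ , _ , ends-with-0 | yes refl with u′ , refl ← ends-with-0 refl = begin-strict
      value d ((u′ ∷ʳ 0) ∷ʳ d)                            ≡⟨ value-∷ʳ (u′ ∷ʳ 0) d ⟩
      value d (u′ ∷ʳ 0) + d * D (suc (length (u′ ∷ʳ 0)))  ≡⟨ cong₂ (λ v l → v + d * D (suc l))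
                                                                  (trans (value-∷ʳ u′ 0) (ℕP.+-identityʳ _)) (length-∷ʳ u′ 0) ⟩
      value d u′ + d * D (suc (suc (length u′)))          <⟨ ℕP.+-monoˡ-< _ (value<D-fuel k u′ |u′|≤k u′-valid) ⟩
      D (suc (length u′)) + d * D (suc (suc (length u′))) ≡⟨ ℕP.+-comm (D (suc (length u′))) _ ⟩
      D (suc (suc (suc (length u′))))                     ≡⟨ cong (λ l → D (suc (suc l))) (sym (length-∷ʳ u′ 0)) ⟩
      D (suc (suc (length (u′ ∷ʳ 0))))                    ≡⟨ cong (λ l → D (suc l)) (sym (length-∷ʳ (u′ ∷ʳ 0) d)) ⟩
      D (suc (length ((u′ ∷ʳ 0) ∷ʳ d)))                   ∎
      where
      open ℕP.≤-Reasoning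
      u′-valid : IsOstrowski d u′
      u′-valid = IsOstrowski-++⁻ˡ u′ [ 0 ] u-valid
      |u′|≤k : length u′ ≤ k
      |u′|≤k = ℕP.≤-pred (ℕP.≤-trans (ℕP.n≤1+n _)
                 (subst (_≤ suc k) (trans (length-∷ʳ (u′ ∷ʳ 0) d) (cong suc (length-∷ʳ u′ 0))) |w|≤1+k))

  value<D : ∀ w → IsOstrowski d w → value d w < D (suc (length w))
  value<D w = value<D-fuel (length w) w ℕP.≤-refl

  D≤value : ∀ w → LastNonzero w → D (length w) ≤ value d w
  D≤value w nonzero with initLast w
  D≤value .[] () | []
  D≤value .(u ∷ʳ x) nonzero | u ∷ʳ′ x = begin
    D (length (u ∷ʳ x))                 ≡⟨ cong D (length-∷ʳ u x) ⟩
    D (suc (length u))                  ≡⟨ ℕP.*-identityˡ _ ⟨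
    1 * D (suc (length u))              ≤⟨ ℕP.*-monoˡ-≤ _ (ℕP.n≢0⇒n>0 (LastNonzero-∷ʳ⁻ u x nonzero)) ⟩
    x * D (suc (length u))              ≤⟨ ℕP.m≤n+m _ (value d u) ⟩
    value d u + x * D (suc (length u))  ≡⟨ value-∷ʳ u x ⟨
    value d (u ∷ʳ x)                    ∎
    where open ℕP.≤-Reasoning

  value<value : ∀ w w′ → IsOstrowski d w → LastNonzero w′ → length w < length w′ → value d w < value d w′
  value<value w w′ valid nonzero |w|<|w′| = begin-strict
    value d w           <⟨ value<D w valid ⟩
    D (suc (length w))  ≤⟨ D-suc-≤ |w|<|w′| ⟩
    D (length w′)       ≤⟨ D≤value w′ nonzero ⟩
    value d w′          ∎
    where
    open ℕP.≤-Reasoning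
    D-suc-≤ : ∀ {i j} → suc i ≤ j → D (suc i) ≤ D j
    D-suc-≤ (s≤s i≤j) = D-suc-mono i≤j

  sameLength-step : ∀ k u u′ x x′ → length (u ∷ʳ x) ≡ k → length (u′ ∷ʳ x′) ≡ k → IsOstrowski d (u ∷ʳ x) →
                    IsOstrowski d (u′ ∷ʳ x′) → value d (u ∷ʳ x) ≡ value d (u′ ∷ʳ x′) → u ∷ʳ x ≡ u′ ∷ʳ x′

  sameLength : ∀ k w w′ → length w ≡ k → length w′ ≡ k → IsOstrowski d w → IsOstrowski d w′ → value d w ≡ value d w′ → w ≡ w′
  sameLength k w w′ l l′ o o′ v with initLast w | initLast w′
  ... | [] | [] = refl
  ... | [] | u′ ∷ʳ′ x′ = ⊥-elim (ℕP.0≢1+n (trans l (trans (sym l′) (length-∷ʳ u′ x′))))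
  ... | u ∷ʳ′ x | [] = ⊥-elim (ℕP.0≢1+n (trans l′ (trans (sym l) (length-∷ʳ u x))))
  ... | u ∷ʳ′ x | u′ ∷ʳ′ x′ = sameLength-step k u u′ x x′ l l′ o o′ v

  sameLength-step zero u u′ x x′ l l′ o o′ v = ⊥-elim (ℕP.0≢1+n (trans (sym l) (length-∷ʳ u x)))
  sameLength-step (suc k) u u′ x x′ l l′ o o′ v with ou , _ ← IsOstrowski-∷ʳ⁻ u x o | ou′ , _ ← IsOstrowski-∷ʳ⁻ u′ x′ o′ =
    cong₂ _∷ʳ_ (sameLength k u u′ |u|≡k |u′|≡k ou ou′ (proj₁ digits)) (proj₂ digits)
    where
    |u|≡k : length u ≡ k
    |u|≡k = ℕP.suc-injective (trans (sym (length-∷ʳ u x)) l)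
    |u′|≡k : length u′ ≡ k
    |u′|≡k = ℕP.suc-injective (trans (sym (length-∷ʳ u′ x′)) l′)
    |u|≡|u′| : length u ≡ length u′
    |u|≡|u′| = trans |u|≡k (sym |u′|≡k)
    instance _ = D-suc-nonZero (length u)
    digits : value d u ≡ value d u′ × x ≡ x′
    digits = divMod-unique (value<D u ou) (subst (λ l → value d u′ < D (suc l)) (sym |u|≡|u′|) (value<D u′ ou′))
               (trans (sym (value-∷ʳ u x)) (trans v (trans (value-∷ʳ u′ x′) (cong (λ l → value d u′ + x′ * D (suc l)) (sym |u|≡|u′|)))))

  ostrowski-unique : ∀ w w′ → IsOstrowski d w → IsOstrowski d w′ → LastNonzero w → LastNonzero w′ → value d w ≡ value d w′ → w ≡ w′
  ostrowski-unique w w′ o o′ n n′ v with ℕP.<-cmp (length w) (length w′)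
  ... | tri≈ _ l _ = sameLength (length w) w w′ refl (sym l) o o′ v
  ... | tri< l _ _ = ⊥-elim (ℕP.<-irrefl v (value<value w w′ o n′ l))
  ... | tri> _ _ l = ⊥-elim (ℕP.<-irrefl (sym v) (value<value w′ w o′ n l))

  RepresentedBy : ℕ → ℕ → Set
  RepresentedBy k n = Σ (List ℕ) λ w → IsOstrowski d w × length w ≡ k × value d w ≡ n

  Representable : ℕ → Set
  Representable k = ∀ n → n < D (suc k) → RepresentedBy k n

  ∷ʳ≢[] : ∀ (u : List ℕ) x → u ∷ʳ x ≢ []
  ∷ʳ≢[] [] x ()
  ∷ʳ≢[] (_ ∷ _) x ()

  representable-0 : Representable 0
  representable-0 zero _ = [] , tt , refl , refl
  representable-0 (suc n) (s≤s ())

  representable-1 : Representable 1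
  representable-1 n h = (n ∷ []) , (subst (n <_) D₂≡d h , tt) , refl , trans (ℕP.+-identityʳ (n * 1)) (ℕP.*-identityʳ n)

  private
    d≢0 : d ≢ 0
    d≢0 eq = ℕP.<-irrefl (sym eq) (ℕP.≤-trans (s≤s z≤n) 2≤d)

    append0 : ∀ w → IsOstrowski d w → IsOstrowski d (w ∷ʳ 0)
    append0 w valid = IsOstrowski-∷ʳ w 0 valid z≤n (λ _ → ℕP.≤-trans (s≤s z≤n) 2≤d) (λ 0≡d → ⊥-elim (d≢0 (sym 0≡d)))

  -- the top digit of n < D (k + 3) is 0 if n < D (k + 2), ⌊n / D (k + 2)⌋ < d if
  -- n < d D (k + 2), and d, preceded by a 0, otherwise
  representable-step : ∀ k → Representable k → Representable (suc k) → Representable (suc (suc k))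
  representable-step k rep-k rep-1+k n n<D with n ℕP.<? D (suc (suc k)) | n ℕP.<? d * D (suc (suc k))
  ... | yes n<M | _ = top0 (rep-1+k n n<M)
    where
    top0 : RepresentedBy (suc k) n → RepresentedBy (suc (suc k)) n
    top0 (w , valid , |w| , value-w) =
      w ∷ʳ 0 , append0 w valid , trans (length-∷ʳ w 0) (cong suc |w|) , trans (value-∷ʳ w 0) (trans (ℕP.+-identityʳ _) value-w)
  ... | no _ | yes n<dM = topQuotient (rep-1+k (n % M) (ℕDM.m%n<n n M))
    where
    M : ℕ
    M = D (suc (suc k))
    instance _ = D-suc-nonZero (suc k)
    x : ℕ
    x = n / M
    x<d : x < d
    x<d = ℕDM.m<n*o⇒m/o<n n<dM
    topQuotient : RepresentedBy (suc k) (n % M) → RepresentedBy (suc (suc k)) n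
    topQuotient (w , valid , |w| , value-w) =
      w ∷ʳ x , IsOstrowski-∷ʳ w x valid (ℕP.<⇒≤ x<d) (λ w≡[] → ⊥-elim (ℕP.0≢1+n (trans (sym (cong length w≡[])) |w|)))
                                      (λ x≡d → ⊥-elim (ℕP.<-irrefl x≡d x<d)) ,
      trans (length-∷ʳ w x) (cong suc |w|) ,
      trans (value-∷ʳ w x) (trans (cong₂ (λ a l → a + x * D (suc l)) value-w |w|) (sym (ℕDM.m≡m%n+[m/n]*n n M)))
  ... | no _ | no n≮dM = top0d (rep-k (n ∸ d * M) (ℕP.m<n+o⇒m∸n<o n _ n<D))
    where
    M : ℕ
    M = D (suc (suc k))
    instance _ = D-suc-nonZero k
    top0d : RepresentedBy k (n ∸ d * M) → RepresentedBy (suc (suc k)) n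
    top0d (w , valid , |w| , value-w) =
      (w ∷ʳ 0) ∷ʳ d ,
      IsOstrowski-∷ʳ (w ∷ʳ 0) d (append0 w valid) ℕP.≤-refl (λ e → ⊥-elim (∷ʳ≢[] w 0 e)) (λ _ → ∷ʳ0-EndsWith0 w) ,
      trans (length-∷ʳ (w ∷ʳ 0) d) (cong suc |w0|) ,
      trans (value-∷ʳ (w ∷ʳ 0) d) (trans (cong₂ (λ a l → a + d * D (suc l)) value-w0 |w0|) (ℕP.m∸n+n≡m (ℕP.≮⇒≥ n≮dM)))
      where
      |w0| : length (w ∷ʳ 0) ≡ suc k
      |w0| = trans (length-∷ʳ w 0) (cong suc |w|)
      value-w0 : value d (w ∷ʳ 0) ≡ n ∸ d * M
      value-w0 = trans (value-∷ʳ w 0) (trans (ℕP.+-identityʳ _) value-w)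

  representable : ∀ k → Representable k × Representable (suc k)
  representable zero = representable-0 , representable-1
  representable (suc k) with representable k
  ... | pk , pk1 = pk1 , representable-step k pk pk1

  n<D[1+n] : ∀ n → n < D (suc n)
  n<D[1+n] zero = s≤s z≤n
  n<D[1+n] (suc n) = ℕP.<-≤-trans (s≤s (n<D[1+n] n)) (D-suc-< n)

  trimCons : ℕ → List ℕ → List ℕ
  trimCons x (y ∷ ys) = x ∷ y ∷ ys
  trimCons zero [] = []
  trimCons (suc x) [] = suc x ∷ []

  dropTrailingZeros : List ℕ → List ℕ
  dropTrailingZeros [] = []
  dropTrailingZeros (x ∷ xs) = trimCons x (dropTrailingZeros xs)

  dropTrailingZeros-valueFrom : ∀ j w → valueFrom d j (dropTrailingZeros w) ≡ valueFrom d j w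
  dropTrailingZeros-valueFrom j [] = refl
  dropTrailingZeros-valueFrom j (x ∷ xs) = go x (dropTrailingZeros xs) (dropTrailingZeros-valueFrom (suc j) xs)
    where
    go : ∀ x s → valueFrom d (suc j) s ≡ valueFrom d (suc j) xs → valueFrom d j (trimCons x s) ≡ x * D j + valueFrom d (suc j) xs
    go zero [] e = e
    go (suc x) [] e = cong (λ z → suc x * D j + z) e
    go x (y ∷ ys) e = cong (λ z → x * D j + z) e

  dropTrailingZeros-OstTail : ∀ p w → OstTail d p w → OstTail d p (dropTrailingZeros w)
  dropTrailingZeros-OstTail p [] _ = tt
  dropTrailingZeros-OstTail p (x ∷ xs) (hx , cx , r) = go x (dropTrailingZeros xs) (dropTrailingZeros-OstTail x xs r) hx cx
    where
    go : ∀ x s → OstTail d x s → x ≤ d → (x ≡ d → p ≡ 0) → OstTail d p (trimCons x s)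
    go zero [] _ _ _ = tt
    go (suc x) [] _ h c = h , c , tt
    go x (y ∷ ys) o h c = h , c , o

  dropTrailingZeros-IsOstrowski : ∀ w → IsOstrowski d w → IsOstrowski d (dropTrailingZeros w)
  dropTrailingZeros-IsOstrowski [] _ = tt
  dropTrailingZeros-IsOstrowski (x ∷ xs) (hx , r) = go x (dropTrailingZeros xs) (dropTrailingZeros-OstTail x xs r) hx
    where
    go : ∀ x s → OstTail d x s → x < d → IsOstrowski d (trimCons x s)
    go zero [] _ _ = tt
    go (suc x) [] _ h = h , tt
    go x (y ∷ ys) o h = h , o

  dropTrailingZeros-LastNonzero : ∀ w → dropTrailingZeros w ≡ [] ⊎ LastNonzero (dropTrailingZeros w)
  dropTrailingZeros-LastNonzero [] = inj₁ refl
  dropTrailingZeros-LastNonzero (x ∷ xs) = go x (dropTrailingZeros xs) (dropTrailingZeros-LastNonzero xs)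
    where
    go : ∀ x s → s ≡ [] ⊎ LastNonzero s → trimCons x s ≡ [] ⊎ LastNonzero (trimCons x s)
    go zero [] _ = inj₁ refl
    go (suc x) [] _ = inj₂ (λ ())
    go x (y ∷ ys) (inj₂ h) = inj₂ h
    go x (y ∷ ys) (inj₁ ())

  private
    padded : ∀ n → RepresentedBy n n
    padded n = proj₁ (representable n) n (n<D[1+n] n)

  ostrowski : ℕ → List ℕ
  ostrowski n = dropTrailingZeros (proj₁ (padded n))

  ostrowski-IsOstrowski : ∀ n → IsOstrowski d (ostrowski n)
  ostrowski-IsOstrowski n = dropTrailingZeros-IsOstrowski _ (proj₁ (proj₂ (padded n)))

  ostrowski-value : ∀ n → value d (ostrowski n) ≡ n
  ostrowski-value n = trans (dropTrailingZeros-valueFrom 1 (proj₁ (padded n))) (proj₂ (proj₂ (proj₂ (padded n))))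

  ostrowski-LastNonzero : ∀ n → 1 ≤ n → LastNonzero (ostrowski n)
  ostrowski-LastNonzero n h with dropTrailingZeros-LastNonzero (proj₁ (padded n))
  ... | inj₂ l = l
  ... | inj₁ e = ⊥-elim (ℕP.<-irrefl (trans (sym (cong (value d) e)) (ostrowski-value n)) h)

  IsOstrowski⇒OstTail0 : ∀ c → IsOstrowski d c → OstTail d 0 c
  IsOstrowski⇒OstTail0 [] _ = tt
  IsOstrowski⇒OstTail0 (x ∷ c) (h , r) = ℕP.<⇒≤ h , (λ _ → refl) , r

  LastNonzero-0∷⁻ : ∀ v → LastNonzero (0 ∷ v) → LastNonzero v
  LastNonzero-0∷⁻ [] h = ⊥-elim (h refl)
  LastNonzero-0∷⁻ (y ∷ v) h = h

  LastNonzero-0∷ : ∀ v → LastNonzero v → LastNonzero (0 ∷ v)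
  LastNonzero-0∷ (y ∷ v) h = h

  value-pos : ∀ w → LastNonzero w → 1 ≤ value d w
  value-pos (x ∷ w) nonzero = ℕP.≤-trans (D-suc-pos (length w)) (D≤value (x ∷ w) nonzero)

  ostrowski-value⁻¹ : ∀ w → IsOstrowski d w → LastNonzero w → w ≡ ostrowski (value d w)
  ostrowski-value⁻¹ w valid nonzero =
    ostrowski-unique w (ostrowski (value d w)) valid (ostrowski-IsOstrowski (value d w))
                     nonzero (ostrowski-LastNonzero (value d w) (value-pos w nonzero)) (sym (ostrowski-value (value d w)))


-- Writing a = value u and b = value (0 u) for an Ostrowski word u, we have
-- b + d < α (a + 1) < b + d + 1.  The upper bound has to be strengthened to
-- α a < b + 1 for tails that follow a digit 0, since these may start with d.
module ShiftBounds (d : ℕ) (2≤d : 2 ℕ.≤ d) where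

  open import Data.Nat using (zero; suc; _≤_; _<_; z≤n)
  open import Data.Integer using (ℤ; +_; _+_; _*_; -_; 0ℤ; +≤+)
  import Data.Integer.Properties as ℤP
  open import Data.Integer.Tactic.RingSolver using (solve-∀)
  open import Data.List using (List; []; _∷_)
  open import Data.Product using (Σ; _×_; _,_)
  open import Data.Unit using (tt)
  open import Data.Empty using (⊥-elim)
  open import Relation.Binary.PropositionalEquality
  open AlphaPositivity d
  open OstrowskiNumeration d 2≤d using (D₂≡d; valueFrom-rec; 1≤d)

  val val⁺ : List ℕ → ℤ
  val u = + valueFrom d 1 u
  val⁺ u = + valueFrom d 2 u

  val-∷ : ∀ x u → val (x ∷ u) ≡ + x + val⁺ u
  val-∷ x u = trans (ℤP.pos-+ (x ℕ.* 1) (valueFrom d 2 u)) (cong (λ z → + z + val⁺ u) (ℕP.*-identityʳ x))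

  val⁺-∷ : ∀ x u → val⁺ (x ∷ u) ≡ + x * + d + (+ d * val⁺ u + val u)
  val⁺-∷ x u = trans (ℤP.pos-+ (x ℕ.* Dseq d 2) (valueFrom d 3 u))
    (cong₂ _+_ (trans (cong (λ z → + (x ℕ.* z)) D₂≡d) (ℤP.pos-* x d))
               (trans (cong +_ (valueFrom-rec 1 u))
                      (trans (ℤP.pos-+ (d ℕ.* valueFrom d 2 u) (valueFrom d 1 u))
                             (cong (_+ val u) (ℤP.pos-* d (valueFrom d 2 u))))))

  ShiftBelow : List ℕ → Set
  ShiftBelow u = αPos (- (val⁺ u + + d)) (val u + + 1)

  ShiftAbove : ℕ → List ℕ → Set
  ShiftAbove zero u = αPos (val⁺ u + + 1) (- val u)
  ShiftAbove (suc _) u = αPos (val⁺ u + + d + + 1) (- (val u + + 1))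

  private
    d≡x+ : ∀ {x} → x ≤ d → Σ ℕ λ k → + d ≡ + x + + k
    d≡x+ {x} h with k , x+k≡d ← ℕP.m≤n⇒∃[o]m+o≡n h = k , trans (cong +_ (sym x+k≡d)) (ℤP.pos-+ x k)

  shiftBelow-∷ : ∀ x u → (x ≡ 0 → ShiftAbove 0 u) → (x ≢ 0 → ShiftAbove 1 u) → ShiftBelow (x ∷ u)
  shiftBelow-∷ x u h0 h1 = αPos-/α (αPos-cong (αx+b+1>a x h0 h1) (cong (_+ + 1) (sym (val-∷ x u))) e)
    where
    αx+b+1>a : ∀ x → (x ≡ 0 → ShiftAbove 0 u) → (x ≢ 0 → ShiftAbove 1 u) → αPos (+ x + val⁺ u + + 1) (- val u)
    αx+b+1>a zero h0 _ = αPos-cong (h0 refl) (lemma (val⁺ u)) refl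
      where
      lemma : ∀ b → b + + 1 ≡ + 0 + b + + 1
      lemma = solve-∀
    αx+b+1>a (suc x) _ h1 =
      αPos-cong (αPos-+nonNeg (αPos-+ (h1 (λ ())) (α-d>0 1≤d)) (+≤+ {0} {suc x} z≤n) (+≤+ {0} {0} z≤n))
                (lemma₁ (+ suc x) (val⁺ u) (+ d)) (lemma₂ (val u))
      where
      lemma₁ : ∀ X b δ → b + δ + + 1 + - δ + X ≡ X + b + + 1
      lemma₁ = solve-∀
      lemma₂ : ∀ a → - (a + + 1) + + 1 + 0ℤ ≡ - a
      lemma₂ = solve-∀
    lemma : ∀ X a b δ → - a ≡ - (X * δ + (δ * b + a) + δ) + δ * (X + b + + 1)
    lemma = solve-∀
    e : - val u ≡ - (val⁺ (x ∷ u) + + d) + + d * (val (x ∷ u) + + 1)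
    e = trans (lemma (+ x) (val u) (val⁺ u) (+ d))
              (cong₂ (λ s t → - (s + + d) + + d * (t + + 1)) (sym (val⁺-∷ x u)) (sym (val-∷ x u)))

  shiftAbove0-∷ : ∀ x u → x ≤ d → ShiftBelow u → ShiftAbove 0 (x ∷ u)
  shiftAbove0-∷ x u x≤d below with k , d≡x+k ← d≡x+ x≤d =
    αPos-/α (αPos-cong (αPos-+nonNeg below (+≤+ {0} {k} z≤n) (+≤+ {0} {0} z≤n)) e₁ e₂)
    where
    lemma₁ : ∀ X K b → - (b + (X + K)) + K ≡ - (X + b)
    lemma₁ = solve-∀
    e₁ : - (val⁺ u + + d) + + k ≡ - val (x ∷ u)
    e₁ = trans (cong (λ z → - (val⁺ u + z) + + k) d≡x+k)
               (trans (lemma₁ (+ x) (+ k) (val⁺ u)) (cong -_ (sym (val-∷ x u))))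
    lemma₂ : ∀ X a b δ → a + + 1 + 0ℤ ≡ (X * δ + (δ * b + a) + + 1) + δ * (- (X + b))
    lemma₂ = solve-∀
    e₂ : val u + + 1 + 0ℤ ≡ (val⁺ (x ∷ u) + + 1) + + d * (- val (x ∷ u))
    e₂ = trans (lemma₂ (+ x) (val u) (val⁺ u) (+ d))
               (cong₂ (λ s t → (s + + 1) + + d * (- t)) (sym (val⁺-∷ x u)) (sym (val-∷ x u)))

  shiftAbove1-∷ : ∀ x u → x < d → ShiftBelow u → ShiftAbove 1 (x ∷ u)
  shiftAbove1-∷ x u x<d below with k , d≡1+x+k ← d≡x+ x<d =
    αPos-/α (αPos-cong (αPos-+nonNeg below (+≤+ {0} {k} z≤n) (+≤+ {0} {0} z≤n)) e₁ e₂)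
    where
    lemma₁ : ∀ X K b → - (b + (+ 1 + X + K)) + K ≡ - (X + b + + 1)
    lemma₁ = solve-∀
    e₁ : - (val⁺ u + + d) + + k ≡ - (val (x ∷ u) + + 1)
    e₁ = trans (cong (λ z → - (val⁺ u + z) + + k) (trans d≡1+x+k (cong (_+ + k) (ℤP.pos-+ 1 x))))
               (trans (lemma₁ (+ x) (+ k) (val⁺ u)) (cong (λ z → - (z + + 1)) (sym (val-∷ x u))))
    lemma₂ : ∀ X a b δ → a + + 1 + 0ℤ ≡ (X * δ + (δ * b + a) + δ + + 1) + δ * (- (X + b + + 1))
    lemma₂ = solve-∀
    e₂ : val u + + 1 + 0ℤ ≡ (val⁺ (x ∷ u) + + d + + 1) + + d * (- (val (x ∷ u) + + 1))
    e₂ = trans (lemma₂ (+ x) (val u) (val⁺ u) (+ d))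
               (cong₂ (λ s t → (s + + d + + 1) + + d * (- (t + + 1))) (sym (val⁺-∷ x u)) (sym (val-∷ x u)))

  shiftBounds-OstTail : ∀ p u → OstTail d p u → ShiftBelow u × ShiftAbove p u
  shiftBounds-OstTail p [] _ = α-d>0 1≤d , above-[] p
    where
    above-[] : ∀ p → ShiftAbove p []
    above-[] zero = 1>0 1≤d
    above-[] (suc _) = αPos-cong (d+1-α>0 2≤d) (trans (ℤP.pos-+ 1 d) (ℤP.+-comm (+ 1) (+ d))) refl
  shiftBounds-OstTail p (x ∷ u) (x≤d , x≡d⇒p≡0 , tail) with below , above ← shiftBounds-OstTail x u tail =
    shiftBelow-∷ x u (λ x≡0 → subst (λ z → ShiftAbove z u) x≡0 above) (above-nonzero x above) , above-∷ p x≡d⇒p≡0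
    where
    above-nonzero : ∀ x → ShiftAbove x u → x ≢ 0 → ShiftAbove 1 u
    above-nonzero zero _ x≢0 = ⊥-elim (x≢0 refl)
    above-nonzero (suc _) above _ = above
    above-∷ : ∀ p → (x ≡ d → p ≡ 0) → ShiftAbove p (x ∷ u)
    above-∷ zero _ = shiftAbove0-∷ x u x≤d below
    above-∷ (suc _) x≡d⇒p≡0 = shiftAbove1-∷ x u (ℕP.≤∧≢⇒< x≤d (λ e → ℕP.0≢1+n (sym (x≡d⇒p≡0 e)))) below

  shiftBounds : ∀ u → IsOstrowski d u → ShiftBelow u × ShiftAbove 1 u
  shiftBounds [] _ = shiftBounds-OstTail 1 [] tt
  shiftBounds (x ∷ u) (x<d , tail) =
    shiftBounds-OstTail 1 (x ∷ u) (ℕP.<⇒≤ x<d , (λ x≡d → ⊥-elim (ℕP.<-irrefl x≡d x<d)) , tail)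

-- shift k is the value of the word 0 w, w the Ostrowski word of k: the
-- second column of the array consists of the shift k with k ≥ 1.
module Shifts (d : ℕ) (2≤d : 2 ℕ.≤ d) where

  open import Data.Nat using (zero; suc; _≤_; _<_; z≤n; s≤s)
  import Data.Nat.Tactic.RingSolver as ℕ-Solver
  open import Data.Integer using (+_; _+_; _-_; -_; 0ℤ)
  import Data.Integer.Properties as ℤP
  open import Data.Integer.Tactic.RingSolver using (solve-∀)
  open import Data.Product using (Σ; _×_; _,_; proj₁; proj₂)
  open import Data.Sum using (inj₁; inj₂)
  open import Data.Empty using (⊥-elim)
  open import Relation.Nullary using (¬_; Dec; yes; no)
  open import Relation.Nullary.Decidable using (map′; _×-dec_)
  open import Relation.Binary.Definitions using (tri<; tri≈; tri>)
  open import Relation.Binary.PropositionalEquality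
  open IntegerSigns using (0<-⇒<)
  open AlphaPositivity d
  open OstrowskiNumeration d 2≤d
  open ShiftBounds d 2≤d

  shift : ℕ → ℕ
  shift k = valueFrom d 2 (ostrowski k)

  val-ostrowski : ∀ k → val (ostrowski k) ≡ + k
  val-ostrowski k = cong +_ (ostrowski-value k)

  shift-below : ∀ k → αPos (- (+ shift k + + d)) (+ k + + 1)
  shift-below k = αPos-cong (proj₁ (shiftBounds (ostrowski k) (ostrowski-IsOstrowski k))) refl (cong (_+ + 1) (val-ostrowski k))

  shift-above : ∀ k → αPos (+ shift k + + d + + 1) (- (+ k + + 1))
  shift-above k = αPos-cong (proj₂ (shiftBounds (ostrowski k) (ostrowski-IsOstrowski k))) refl (cong (λ z → - (z + + 1)) (val-ostrowski k))

  αPos⇒< : ∀ {A B} → αPos (+ A - + B) 0ℤ → B < A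
  αPos⇒< p = ℤP.drop‿+<+ (0<-⇒< (αPos-integer p))

  shift+d≤shift-suc : ∀ k → shift k ℕ.+ d ≤ shift (suc k)
  shift+d≤shift-suc k = ℕP.≤-pred (αPos⇒< (αPos-cong (αPos-+ (αPos-+ (shift-below k) (shift-above (suc k))) (α-d>0 1≤d)) e₁ e₂))
    where
    lemma₁ : ∀ a b δ → - (a + δ) + (b + δ + + 1) + - δ ≡ (+ 1 + b) - (a + δ)
    lemma₁ = solve-∀
    e₁ : - (+ shift k + + d) + (+ shift (suc k) + + d + + 1) + - + d ≡ + suc (shift (suc k)) - + (shift k ℕ.+ d)
    e₁ = trans (lemma₁ (+ shift k) (+ shift (suc k)) (+ d)) (cong₂ _-_ (sym (ℤP.pos-+ 1 (shift (suc k)))) (sym (ℤP.pos-+ (shift k) d)))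
    lemma₂ : ∀ k → k + + 1 + - (+ 1 + k + + 1) + + 1 ≡ 0ℤ
    lemma₂ = solve-∀
    e₂ : + k + + 1 + - (+ suc k + + 1) + + 1 ≡ 0ℤ
    e₂ = trans (cong (λ z → + k + + 1 + - (z + + 1) + + 1) (ℤP.pos-+ 1 k)) (lemma₂ (+ k))

  shift-0 : shift 0 ≡ 0
  shift-0 = ℕP.n<1⇒n≡0 (αPos⇒< (αPos-cong (αPos-+ (shift-below 0) (d+1-α>0 2≤d)) e refl))
    where
    lemma : ∀ a δ → - (a + δ) + (+ 1 + δ) ≡ + 1 - a
    lemma = solve-∀
    e : - (+ shift 0 + + d) + + suc d ≡ + 1 - + shift 0
    e = trans (cong (λ z → - (+ shift 0 + + d) + z) (ℤP.pos-+ 1 d)) (lemma (+ shift 0) (+ d))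

  2k≤shift : ∀ k → 2 ℕ.* k ≤ shift k
  2k≤shift zero = z≤n
  2k≤shift (suc k) = ℕP.≤-trans (ℕP.≤-reflexive (lem k)) (ℕP.≤-trans (ℕP.+-mono-≤ (2k≤shift k) 2≤d) (shift+d≤shift-suc k))
    where
    lem : ∀ k → 2 ℕ.* suc k ≡ 2 ℕ.* k ℕ.+ 2
    lem = ℕ-Solver.solve-∀

  shift-<-suc : ∀ k → shift k < shift (suc k)
  shift-<-suc k = ℕP.<-≤-trans (ℕP.m<m+n (shift k) (ℕP.≤-trans (s≤s z≤n) 2≤d)) (shift+d≤shift-suc k)

  shift-strictMono : ∀ {i j} → i < j → shift i < shift j
  shift-strictMono {i} {suc j} (s≤s h) with ℕP.m≤n⇒m<n∨m≡n h
  ... | inj₁ lt = ℕP.<-trans (shift-strictMono lt) (shift-<-suc j)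
  ... | inj₂ refl = shift-<-suc j

  shift-mono : ∀ {i j} → i ≤ j → shift i ≤ shift j
  shift-mono {i} {j} h with ℕP.m≤n⇒m<n∨m≡n h
  ... | inj₁ lt = ℕP.<⇒≤ (shift-strictMono lt)
  ... | inj₂ refl = ℕP.≤-refl

  shift-cancel-< : ∀ {i j} → shift i < shift j → i < j
  shift-cancel-< {i} {j} h with ℕP.<-cmp i j
  ... | tri< lt _ _ = lt
  ... | tri≈ _ refl _ = ⊥-elim (ℕP.<-irrefl refl h)
  ... | tri> _ _ gt = ⊥-elim (ℕP.<-asym h (shift-strictMono gt))

  IsShift : ℕ → Set
  IsShift n = Σ ℕ λ k → 1 ≤ k × shift k ≡ n

  k≤shift : ∀ k → k ≤ shift k
  k≤shift k = ℕP.≤-trans (ℕP.m≤m+n k (k ℕ.+ 0)) (2k≤shift k)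

  isShift? : ∀ n → Dec (IsShift n)
  isShift? n = map′ (λ (k , _ , k-shift) → k , k-shift)
                    (λ (k , k-shift) → k , s≤s (subst (k ≤_) (proj₂ k-shift) (k≤shift k)) , k-shift)
                    (ℕP.anyUpTo? (λ k → (1 ℕP.≤? k) ×-dec (shift k ℕP.≟ n)) (suc n))

  #shifts #nonShifts : ℕ → ℕ
  #shifts zero = 0
  #shifts (suc n) with isShift? (suc n)
  ... | yes _ = suc (#shifts n)
  ... | no _ = #shifts n
  #nonShifts zero = 0
  #nonShifts (suc n) with isShift? (suc n)
  ... | yes _ = #nonShifts n
  ... | no _ = suc (#nonShifts n)

  #nonShifts+#shifts : ∀ n → #nonShifts n ℕ.+ #shifts n ≡ n
  #nonShifts+#shifts zero = refl
  #nonShifts+#shifts (suc n) with isShift? (suc n)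
  ... | yes _ = trans (ℕP.+-suc (#nonShifts n) (#shifts n)) (cong suc (#nonShifts+#shifts n))
  ... | no _ = cong suc (#nonShifts+#shifts n)

  shift-#shifts : ∀ n → shift (#shifts n) ≤ n × n < shift (suc (#shifts n))
  shift-#shifts zero = ℕP.≤-reflexive shift-0 , subst (_< shift 1) shift-0 (shift-<-suc 0)
  shift-#shifts (suc n) with shift-#shifts n | isShift? (suc n)
  ... | (h1 , h2) | yes (k , k1 , gk) = ℕP.≤-reflexive e , subst (_< shift (suc (suc (#shifts n)))) e (shift-<-suc (suc (#shifts n)))
    where
    c : ℕ
    c = #shifts n
    kc : suc c ≤ k
    kc = shift-cancel-< (ℕP.≤-<-trans h1 (subst (n <_) (sym gk) ℕP.≤-refl))
    e : shift (suc c) ≡ suc n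
    e = ℕP.≤-antisym (subst (shift (suc c) ≤_) gk (shift-mono kc)) h2
  ... | (h1 , h2) | no ¬t = ℕP.m≤n⇒m≤1+n h1 , lt
    where
    c : ℕ
    c = #shifts n
    lt : suc n < shift (suc c)
    lt with ℕP.m≤n⇒m<n∨m≡n h2
    ... | inj₁ l = l
    ... | inj₂ e = ⊥-elim (¬t (suc c , s≤s z≤n , sym e))

  2*#shifts≤ : ∀ n → 2 ℕ.* #shifts n ≤ n
  2*#shifts≤ n = ℕP.≤-trans (2k≤shift (#shifts n)) (proj₁ (shift-#shifts n))

  #nonShifts-no : ∀ n → ¬ IsShift (suc n) → #nonShifts (suc n) ≡ suc (#nonShifts n)
  #nonShifts-no n ¬t with isShift? (suc n)
  ... | yes t = ⊥-elim (¬t t)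
  ... | no _ = refl

  #nonShifts-yes : ∀ n → IsShift (suc n) → #nonShifts (suc n) ≡ #nonShifts n
  #nonShifts-yes n t with isShift? (suc n)
  ... | yes _ = refl
  ... | no ¬t = ⊥-elim (¬t t)

  IsNthNonShift : ℕ → ℕ → Set
  IsNthNonShift m n = 1 ≤ n × ¬ IsShift n × #nonShifts n ≡ m

  nthNonShift-≤ : ∀ N m → 1 ≤ m → m ≤ #nonShifts N → Σ ℕ (IsNthNonShift m)
  nthNonShift-≤ zero m 1≤m m≤0 = ⊥-elim (ℕP.<-irrefl refl (ℕP.≤-trans 1≤m m≤0))
  nthNonShift-≤ (suc N) m 1≤m m≤# with m ℕP.≤? #nonShifts N
  ... | yes m≤#N = nthNonShift-≤ N m 1≤m m≤#N
  ... | no m≰#N = new (isShift? (suc N))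
    where
    new : Dec (IsShift (suc N)) → Σ ℕ (IsNthNonShift m)
    new (yes shift) = ⊥-elim (m≰#N (subst (m ≤_) (#nonShifts-yes N shift) m≤#))
    new (no ¬shift) =
      suc N , s≤s z≤n , ¬shift ,
      trans (#nonShifts-no N ¬shift) (ℕP.≤-antisym (ℕP.≰⇒> m≰#N) (subst (m ≤_) (#nonShifts-no N ¬shift) m≤#))

  m≤#nonShifts[2m] : ∀ m → m ≤ #nonShifts (2 ℕ.* m)
  m≤#nonShifts[2m] m = ℕP.+-cancelʳ-≤ (#shifts (2 ℕ.* m)) m (#nonShifts (2 ℕ.* m))
    (subst (m ℕ.+ #shifts (2 ℕ.* m) ≤_) (sym (#nonShifts+#shifts (2 ℕ.* m)))
      (ℕP.≤-trans (ℕP.+-monoʳ-≤ m ct≤m) (ℕP.≤-reflexive (lem m))))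
    where
    lem : ∀ m → m ℕ.+ m ≡ 2 ℕ.* m
    lem = ℕ-Solver.solve-∀
    ct≤m : #shifts (2 ℕ.* m) ≤ m
    ct≤m = ℕP.*-cancelˡ-≤ 2 (2*#shifts≤ (2 ℕ.* m))

  nthNonShift : ∀ m → 1 ≤ m → Σ ℕ (IsNthNonShift m)
  nthNonShift m 1≤m = nthNonShift-≤ (2 ℕ.* m) m 1≤m (m≤#nonShifts[2m] m)

-- The trimmed words are exactly the Ostrowski words of the positive integers
-- that are not shifts, so the m-th trimmed word represents the m-th such integer.
module FirstColumn (d : ℕ) (2≤d : 2 ℕ.≤ d) where

  open import Data.Nat using (zero; suc; _≤_; _<_; _∸_; z≤n; s≤s)
  open import Data.List using ([]; _∷_)
  open import Data.List.Relation.Unary.All as All using (All; []; _∷_)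
  open import Data.List.Relation.Unary.Any using (here; there)
  open import Data.List.Relation.Unary.AllPairs using ([]; _∷_)
  open import Data.Product using (Σ; _×_; _,_; proj₁; proj₂)
  open import Data.Sum using (inj₁; inj₂)
  open import Data.Empty using (⊥; ⊥-elim)
  open import Relation.Nullary using (¬_; yes; no)
  open import Relation.Binary.PropositionalEquality
  open OstrowskiNumeration d 2≤d
  open Shifts d 2≤d

  ostrowski-Trimmed : ∀ n → 1 ≤ n → ¬ IsShift n → Trimmed d (ostrowski n)
  ostrowski-Trimmed n h ¬t = ostrowski-IsOstrowski n , ostrowski-LastNonzero n h , λ { (v , e , ov) → ¬t (tr v e ov) }
    where
    tr : ∀ v → ostrowski n ≡ 0 ∷ v → IsOstrowski d v → IsShift n
    tr v e ov = value d v , k1 , trans (cong (valueFrom d 2) (sym vk)) (trans (cong (value d) (sym e)) (ostrowski-value n))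
      where
      lv : LastNonzero v
      lv = LastNonzero-0∷⁻ v (subst LastNonzero e (ostrowski-LastNonzero n h))
      k1 : 1 ≤ value d v
      k1 = value-pos v lv
      vk : v ≡ ostrowski (value d v)
      vk = ostrowski-value⁻¹ v ov lv

  IsShift⇒¬Trimmed : ∀ n → IsShift n → ∀ w → Trimmed d w → value d w ≡ n → ⊥
  IsShift⇒¬Trimmed n (k , k1 , gk) w (ostrowski′ , lw , nt) vw = nt (ostrowski k , e , ostrowski-IsOstrowski k)
    where
    e : w ≡ 0 ∷ ostrowski k
    e = ostrowski-unique w (0 ∷ ostrowski k) ostrowski′
          (ℕP.≤-trans (s≤s z≤n) 2≤d , IsOstrowski⇒OstTail0 (ostrowski k) (ostrowski-IsOstrowski k))
          lw (LastNonzero-0∷ (ostrowski k) (ostrowski-LastNonzero k k1)) (trans vw (sym gk))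

  Trimmed⇒ostrowski : ∀ w → Trimmed d w → w ≡ ostrowski (value d w)
  Trimmed⇒ostrowski w (valid , nonzero , _) = ostrowski-value⁻¹ w valid nonzero

  nonShiftWords : ℕ → List (List ℕ)
  nonShiftWords zero = []
  nonShiftWords (suc j) with isShift? (suc j)
  ... | yes _ = nonShiftWords j
  ... | no _ = ostrowski (suc j) ∷ nonShiftWords j

  NonShiftWord : ℕ → List ℕ → Set
  NonShiftWord j v = Σ ℕ λ i → 1 ≤ i × i ≤ j × ¬ IsShift i × v ≡ ostrowski i

  nonShiftWords-sound : ∀ j → All (NonShiftWord j) (nonShiftWords j)
  nonShiftWords-sound zero = []
  nonShiftWords-sound (suc j) with isShift? (suc j)
  ... | yes _ = All.map weaken (nonShiftWords-sound j)
    where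
    weaken : ∀ {v} → NonShiftWord j v → NonShiftWord (suc j) v
    weaken (i , 1≤i , i≤j , ¬shift , refl) = i , 1≤i , ℕP.m≤n⇒m≤1+n i≤j , ¬shift , refl
  ... | no ¬shift = (suc j , s≤s z≤n , ℕP.≤-refl , ¬shift , refl) ∷ All.map weaken (nonShiftWords-sound j)
    where
    weaken : ∀ {v} → NonShiftWord j v → NonShiftWord (suc j) v
    weaken (i , 1≤i , i≤j , ¬shift , refl) = i , 1≤i , ℕP.m≤n⇒m≤1+n i≤j , ¬shift , refl

  ostrowski∈nonShiftWords : ∀ {i} j → 1 ≤ i → i ≤ j → ¬ IsShift i → ostrowski i ∈ nonShiftWords j
  ostrowski∈nonShiftWords zero 1≤i i≤0 _ = ⊥-elim (ℕP.<-irrefl refl (ℕP.≤-trans 1≤i i≤0))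
  ostrowski∈nonShiftWords (suc j) 1≤i i≤1+j ¬shift with isShift? (suc j) | ℕP.m≤n⇒m<n∨m≡n i≤1+j
  ... | yes shift | inj₂ refl = ⊥-elim (¬shift shift)
  ... | no _ | inj₂ refl = here refl
  ... | yes _ | inj₁ i<1+j = ostrowski∈nonShiftWords j 1≤i (ℕP.≤-pred i<1+j) ¬shift
  ... | no _ | inj₁ i<1+j = there (ostrowski∈nonShiftWords j 1≤i (ℕP.≤-pred i<1+j) ¬shift)

  nonShiftWords-unique : ∀ j → Unique (nonShiftWords j)
  nonShiftWords-unique zero = []
  nonShiftWords-unique (suc j) with isShift? (suc j)
  ... | yes _ = nonShiftWords-unique j
  ... | no _ = All.map distinct (nonShiftWords-sound j) ∷ nonShiftWords-unique j
    where
    distinct : ∀ {v} → NonShiftWord j v → ostrowski (suc j) ≢ v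
    distinct (i , _ , i≤j , _ , refl) e =
      ℕP.<-irrefl (trans (sym (ostrowski-value i)) (trans (cong (value d) (sym e)) (ostrowski-value (suc j)))) (s≤s i≤j)

  length-nonShiftWords : ∀ j → length (nonShiftWords j) ≡ #nonShifts j
  length-nonShiftWords zero = refl
  length-nonShiftWords (suc j) with isShift? (suc j)
  ... | yes _ = length-nonShiftWords j
  ... | no _ = cong suc (length-nonShiftWords j)

  Trimmed∈nonShiftWords : ∀ {v} j → Trimmed d v → value d v ≤ j → v ∈ nonShiftWords j
  Trimmed∈nonShiftWords {v} j tv v≤j = subst (_∈ nonShiftWords j) (sym (Trimmed⇒ostrowski v tv))
    (ostrowski∈nonShiftWords j (value-pos v (proj₁ (proj₂ tv))) v≤j (λ shift → IsShift⇒¬Trimmed (value d v) shift v tv refl))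

  NonShiftWord⇒Trimmed : ∀ {j v} → NonShiftWord j v → Trimmed d v × value d v < suc j
  NonShiftWord⇒Trimmed (i , 1≤i , i≤j , ¬shift , refl) =
    ostrowski-Trimmed i 1≤i ¬shift , subst (_< suc _) (sym (ostrowski-value i)) (s≤s i≤j)

  ostrowski-IsMthTrimmed : ∀ {m n} → IsNthNonShift m n → IsMthTrimmed d m (ostrowski n)
  ostrowski-IsMthTrimmed {m} {suc n} (1≤n , ¬shift , #≡m) =
    ostrowski-Trimmed (suc n) 1≤n ¬shift , nonShiftWords n , nonShiftWords-unique n ,
    trans (length-nonShiftWords n) (cong (_∸ 1) (trans (sym (#nonShifts-no n ¬shift)) #≡m)) ,
    All.map (λ w → let tw , lt = NonShiftWord⇒Trimmed w in tw , subst (_ <_) (sym (ostrowski-value (suc n))) lt)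
            (nonShiftWords-sound n) ,
    λ v tv lt → Trimmed∈nonShiftWords n tv (ℕP.≤-pred (subst (value d v <_) (ostrowski-value (suc n)) lt))

  IsMthTrimmed⇒IsNthNonShift : ∀ {m w} → 1 ≤ m → IsMthTrimmed d m w → IsNthNonShift m (value d w)
  IsMthTrimmed⇒IsNthNonShift {m} {w} 1≤m (tw , L , uniqueL , lengthL , smaller , complete) =
    1≤n , ¬shift , #≡m
    where
    1≤n : 1 ≤ value d w
    1≤n = value-pos w (proj₁ (proj₂ tw))
    ¬shift : ¬ IsShift (value d w)
    ¬shift shift = IsShift⇒¬Trimmed (value d w) shift w tw refl
    n : ℕ
    n = value d w ∸ 1
    1+n≡ : suc n ≡ value d w
    1+n≡ = ℕP.m+[n∸m]≡n 1≤n
    L⊆ : ∀ {v} → v ∈ L → v ∈ nonShiftWords n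
    L⊆ v∈L with tv , lt ← All.lookup smaller v∈L = Trimmed∈nonShiftWords n tv (ℕP.≤-pred (subst (_ <_) (sym 1+n≡) lt))
    ⊆L : ∀ {v} → v ∈ nonShiftWords n → v ∈ L
    ⊆L v∈ with tv , lt ← NonShiftWord⇒Trimmed (All.lookup (nonShiftWords-sound n) v∈) = complete _ tv (subst (_ <_) 1+n≡ lt)
    #≡m : #nonShifts (value d w) ≡ m
    #≡m = begin
      #nonShifts (value d w)       ≡⟨ cong #nonShifts (sym 1+n≡) ⟩
      #nonShifts (suc n)           ≡⟨ #nonShifts-no n (subst (λ z → ¬ IsShift z) (sym 1+n≡) ¬shift) ⟩
      suc (#nonShifts n)           ≡⟨ cong suc (sym (length-nonShiftWords n)) ⟩
      suc (length (nonShiftWords n)) ≡⟨ cong suc (sym (Unique-length uniqueL (nonShiftWords-unique n) L⊆ ⊆L)) ⟩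
      suc (length L)               ≡⟨ cong suc lengthL ⟩
      suc (m ∸ 1)                  ≡⟨ ℕP.m+[n∸m]≡n 1≤m ⟩
      m                            ∎
      where open ≡-Reasoning

-- For the Beatty argument y = m α/(α - 1) - 1/(α(α - 1)) and every integer t,
-- d (y - t) = beattyP m t + beattyQ m α.
module BeattyForm (d : ℕ) where

  open import Data.Integer using (ℤ; +_; _+_; _-_; _*_)

  beattyQ : ℕ → ℤ
  beattyQ m = + m + + d - + 1

  beattyP : ℕ → ℤ → ℤ
  beattyP m t = beattyQ m - + d * (t + + d)

  -- 2 (beattyP m t + beattyQ m α) = beattyA m t + beattyQ m √(d² + 4)
  beattyA : ℕ → ℤ → ℤ
  beattyA m t = + 2 * beattyP m t + beattyQ m * + d

-- For the m-th non-shift n, with K = #shifts n shifts up to n, we have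
-- n = m + K and shift K < n < shift (K + 1), which the shift bounds turn into
-- α (K + 1) < n + d and n + 1 + d < α (K + 2).
module BeattyInequalities (d : ℕ) (2≤d : 2 ℕ.≤ d) where

  open import Data.Nat using (zero; suc; _<_; _∸_; z≤n; s≤s)
  open import Data.Integer using (+_; _+_; _-_; _*_; -_)
  import Data.Integer.Properties as ℤP
  open import Data.Integer.Tactic.RingSolver using (solve-∀)
  open import Data.Product using (_,_; proj₁; proj₂)
  open import Data.Sum using (inj₁; inj₂)
  open import Data.Empty using (⊥-elim)
  open import Relation.Binary.PropositionalEquality
  open IntegerSigns using (0≤pos)
  open AlphaPositivity d
  open Shifts d 2≤d
  open BeattyForm d

  module _ {m n} (nth : IsNthNonShift m n) where

    private
      K : ℕ
      K = #shifts n

      +n≡+m++K : + n ≡ + m + + K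
      +n≡+m++K = trans (cong +_ (trans (sym (#nonShifts+#shifts n)) (cong (ℕ._+ K) (proj₂ (proj₂ nth)))))
                       (ℤP.pos-+ m K)

    shift-#shifts<n : shift K < n
    shift-#shifts<n with #shifts n | proj₁ (shift-#shifts n)
    ... | zero | _ = subst (_< n) (sym shift-0) (proj₁ nth)
    ... | suc k | shift≤n with ℕP.m≤n⇒m<n∨m≡n shift≤n
    ... | inj₁ shift<n = shift<n
    ... | inj₂ shift≡n = ⊥-elim (proj₁ (proj₂ nth) (suc k , s≤s z≤n , shift≡n))

    α[K+1]<n+d : αPos (+ n + + d) (- (+ K + + 1))
    α[K+1]<n+d = αPos-cong (αPos-+nonNeg (shift-above K) (0≤pos gap) (0≤pos 0)) e (ℤP.+-identityʳ _)
      where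
      gap : ℕ
      gap = n ∸ suc (shift K)
      lemma : ∀ s δ x → s + δ + + 1 + x ≡ (+ 1 + s + x) + δ
      lemma = solve-∀
      e : + shift K + + d + + 1 + + gap ≡ + n + + d
      e = trans (lemma (+ shift K) (+ d) (+ gap))
                (cong (_+ + d) (trans (cong (_+ + gap) (sym (ℤP.pos-+ 1 (shift K))))
                                      (trans (sym (ℤP.pos-+ (suc (shift K)) gap)) (cong +_ (ℕP.m+[n∸m]≡n shift-#shifts<n)))))

    n+1+d<α[K+2] : αPos (- (+ n + + 1 + + d)) (+ K + + 1 + + 1)
    n+1+d<α[K+2] = αPos-cong (αPos-+nonNeg (shift-below (suc K)) (0≤pos gap) (0≤pos 0)) e₁ e₂
      where
      gap : ℕ
      gap = shift (suc K) ∸ suc n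
      lemma₁ : ∀ δ x n → - ((+ 1 + n + x) + δ) + x ≡ - (n + + 1 + δ)
      lemma₁ = solve-∀
      +shift≡ : + shift (suc K) ≡ + 1 + + n + + gap
      +shift≡ = trans (cong +_ (sym (ℕP.m+[n∸m]≡n (proj₂ (shift-#shifts n)))))
                      (trans (ℤP.pos-+ (suc n) gap) (cong (_+ + gap) (ℤP.pos-+ 1 n)))
      e₁ : - (+ shift (suc K) + + d) + + gap ≡ - (+ n + + 1 + + d)
      e₁ = trans (cong (λ z → - (z + + d) + + gap) +shift≡) (lemma₁ (+ d) (+ gap) (+ n))
      e₂ : + suc K + + 1 + + 0 ≡ + K + + 1 + + 1
      e₂ = trans (ℤP.+-identityʳ _) (cong (_+ + 1) (trans (ℤP.pos-+ 1 K) (ℤP.+-comm (+ 1) (+ K))))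

    beatty-lower : αPos (beattyP m (+ n)) (beattyQ m)
    beatty-lower = αPos-cong (αPos-*[1+α⁻¹] α[K+1]<n+d) e₁ e₂
      where
      lemma₁ : ∀ m K δ → (m + K + δ) + (- (K + + 1) - δ * (m + K + δ)) ≡ m + δ - + 1 - δ * (m + K + δ)
      lemma₁ = solve-∀
      e₁ : (+ n + + d) + (- (+ K + + 1) - + d * (+ n + + d)) ≡ beattyP m (+ n)
      e₁ = trans (cong (λ z → (z + + d) + (- (+ K + + 1) - + d * (z + + d))) +n≡+m++K)
                 (trans (lemma₁ (+ m) (+ K) (+ d)) (cong (λ z → beattyQ m - + d * (z + + d)) (sym +n≡+m++K)))
      lemma₂ : ∀ m K δ → - (K + + 1) + (m + K + δ) ≡ m + δ - + 1
      lemma₂ = solve-∀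
      e₂ : - (+ K + + 1) + (+ n + + d) ≡ beattyQ m
      e₂ = trans (cong (λ z → - (+ K + + 1) + (z + + d)) +n≡+m++K) (lemma₂ (+ m) (+ K) (+ d))

    beatty-upper : αPos (- beattyP m (+ n + + 1)) (- beattyQ m)
    beatty-upper = αPos-cong (αPos-*[1+α⁻¹] n+1+d<α[K+2]) e₁ e₂
      where
      lemma₁ : ∀ m K δ → - (m + K + + 1 + δ) + ((K + + 1 + + 1) - δ * - (m + K + + 1 + δ))
                         ≡ - (m + δ - + 1 - δ * (m + K + + 1 + δ))
      lemma₁ = solve-∀
      e₁ : - (+ n + + 1 + + d) + ((+ K + + 1 + + 1) - + d * - (+ n + + 1 + + d)) ≡ - beattyP m (+ n + + 1)
      e₁ = trans (cong (λ z → - (z + + 1 + + d) + ((+ K + + 1 + + 1) - + d * - (z + + 1 + + d))) +n≡+m++K)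
                 (trans (lemma₁ (+ m) (+ K) (+ d)) (cong (λ z → - (beattyQ m - + d * (z + + 1 + + d))) (sym +n≡+m++K)))
      lemma₂ : ∀ m K δ → (K + + 1 + + 1) + - (m + K + + 1 + δ) ≡ - (m + δ - + 1)
      lemma₂ = solve-∀
      e₂ : (+ K + + 1 + + 1) + - (+ n + + 1 + + d) ≡ - beattyQ m
      e₂ = trans (cong (λ z → (+ K + + 1 + + 1) + - (z + + 1 + + d)) +n≡+m++K) (lemma₂ (+ m) (+ K) (+ d))

-- N(P + Qα) = P² + dPQ - Q², and D²ₖ₊₁ N = Q² cₖ₊₁ + (P Dₖ₊₁ + Q Dₖ₊₂)(P Dₖ₊₁ - Q Dₖ)
-- with the Cassini sign cₖ = ±1 alternating, so the eventual positivity of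
-- P Dₙ + Q Dₙ₊₁ controls the sign of the norm and hence of 2P + dQ ± Q √(d² + 4).
module NormBridge (d : ℕ) where

  open import Data.Nat using (zero; suc)
  open import Data.Integer using (ℤ; +_; _+_; _*_; -_; _-_; 0ℤ; +≤+)
  import Data.Integer.Properties as ℤP
  open import Data.Integer.Tactic.RingSolver using (solve-∀)
  open import Data.Product using (Σ; _×_; _,_; proj₁; proj₂)
  open import Data.Sum using (_⊎_; inj₁; inj₂)
  open import Data.Empty using (⊥-elim)
  open import Relation.Nullary using (yes; no)
  open import Relation.Binary.PropositionalEquality
  open IntegerSigns
  open AlphaPositivity d

  private
    δ : ℤ
    δ = + d

    0<2 : 0ℤ ℤ.< + 2
    0<2 = ℤ.+<+ (ℕ.s≤s ℕ.z≤n)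

    0<4 : 0ℤ ℤ.< + 4
    0<4 = ℤ.+<+ (ℕ.s≤s ℕ.z≤n)

  cassini : ℕ → ℤ
  cassini k = Dᶻ (suc k) * Dᶻ (suc k) - δ * Dᶻ (suc k) * Dᶻ k - Dᶻ k * Dᶻ k

  cassini-0 : cassini 0 ≡ + 1
  cassini-0 = trans (cong₂ (λ x y → x * x - δ * x * y - y * y) (Dᶻ-def 1) (Dᶻ-def 0)) (lemma δ)
    where
    lemma : ∀ δ → + 1 * + 1 - δ * + 1 * + 0 - + 0 * + 0 ≡ + 1
    lemma = solve-∀

  cassini-suc : ∀ k → cassini (suc k) ≡ - cassini k
  cassini-suc k = trans (cong (λ a → a * a - δ * a * Dᶻ (suc k) - Dᶻ (suc k) * Dᶻ (suc k)) (Dᶻ-rec k))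
                 (lemma δ (Dᶻ (suc k)) (Dᶻ k))
    where
    lemma : ∀ δ b c → (δ * b + c) * (δ * b + c) - δ * (δ * b + c) * b - b * b ≡ - (b * b - δ * b * c - c * c)
    lemma = solve-∀

  cassini-±1 : ∀ k → (cassini k ≡ + 1) ⊎ (cassini k ≡ - + 1)
  cassini-±1 zero = inj₁ cassini-0
  cassini-±1 (suc k) with cassini-±1 k
  ... | inj₁ e = inj₂ (trans (cassini-suc k) (cong -_ e))
  ... | inj₂ e = inj₁ (trans (cassini-suc k) (cong -_ e))

  norm : ℤ → ℤ → ℤ
  norm P Q = P * P + P * Q * δ - Q * Q

  norm-cassini : ∀ P Q k → Dᶻ (suc k) * Dᶻ (suc k) * norm P Q
                           ≡ Q * Q * cassini (suc k) + lin P Q (suc k) * (P * Dᶻ (suc k) - Q * Dᶻ k)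
  norm-cassini P Q k = trans (lemma P Q δ (Dᶻ (suc k)) (Dᶻ k))
     (cong₂ (λ x y → Q * Q * x + y * (P * Dᶻ (suc k) - Q * Dᶻ k))
        (cong (λ a → a * a - δ * a * Dᶻ (suc k) - Dᶻ (suc k) * Dᶻ (suc k)) (sym (Dᶻ-rec k)))
        (trans (cong (λ a → P * Dᶻ (suc k) + Q * a) (sym (Dᶻ-rec k))) (sym (lin-def P Q (suc k)))))
    where
    lemma : ∀ P Q δ b c → b * b * (P * P + P * Q * δ - Q * Q) ≡
      Q * Q * ((δ * b + c) * (δ * b + c) - δ * (δ * b + c) * b - b * b) + (P * b + Q * (δ * b + c)) * (P * b - Q * c)
    lemma = solve-∀

  Dᶻ-nonNeg : ∀ k → 0ℤ ℤ.≤ Dᶻ k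
  Dᶻ-nonNeg k = subst (0ℤ ℤ.≤_) (sym (Dᶻ-def k)) (+≤+ ℕ.z≤n)

  norm-pos : ∀ P Q k → cassini (suc k) ≡ + 1 → 0ℤ ℤ.< lin P Q (suc k) → 0ℤ ℤ.< - Q → 0ℤ ℤ.< norm P Q
  norm-pos P Q k hc hl hq = 0<*-cancelˡ (0≤* (Dᶻ-nonNeg (suc k)) (Dᶻ-nonNeg (suc k)))
    (subst (0ℤ ℤ.<_) (sym (trans (norm-cassini P Q k) (cong (λ z → Q * Q * z + Lk * (P * b - Q * c)) hc)))
      (subst (0ℤ ℤ.<_) e (0<+ (0<* hq hq) (ℤP.<⇒≤ (0<* hl (0<+ hl (0≤* (ℤP.<⇒≤ hq) (0≤+ (Dᶻ-nonNeg (suc (suc k))) (Dᶻ-nonNeg k)))))))))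
    where
    b : ℤ
    b = Dᶻ (suc k)
    c : ℤ
    c = Dᶻ k
    Lk : ℤ
    Lk = lin P Q (suc k)
    a : ℤ
    a = Dᶻ (suc (suc k))
    e0 : Lk ≡ P * b + Q * a
    e0 = lin-def P Q (suc k)
    lemma : ∀ P Q b c a → - Q * - Q + (P * b + Q * a) * ((P * b + Q * a) + - Q * (a + c)) ≡ Q * Q * + 1 + (P * b + Q * a) * (P * b - Q * c)
    lemma = solve-∀
    e : - Q * - Q + Lk * (Lk + - Q * (a + c)) ≡ Q * Q * + 1 + Lk * (P * b - Q * c)
    e = trans (cong (λ z → - Q * - Q + z * (z + - Q * (a + c))) e0) (trans (lemma P Q b c a) (cong (λ z → Q * Q * + 1 + z * (P * b - Q * c)) (sym e0)))

  norm-neg : ∀ P Q k → cassini (suc k) ≡ - + 1 → 0ℤ ℤ.< lin P Q (suc k) → 0ℤ ℤ.< - P → 0ℤ ℤ.< Q → 0ℤ ℤ.< - norm P Q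
  norm-neg P Q k hc hl hp hq = 0<*-cancelˡ (0≤* (Dᶻ-nonNeg (suc k)) (Dᶻ-nonNeg (suc k)))
    (subst (0ℤ ℤ.<_) e
      (0<+ (0<* hq hq) (0≤* (ℤP.<⇒≤ hl) (0≤+ (0≤* (ℤP.<⇒≤ hq) (Dᶻ-nonNeg k)) (0≤* (ℤP.<⇒≤ hp) (Dᶻ-nonNeg (suc k)))))))
    where
    b : ℤ
    b = Dᶻ (suc k)
    c : ℤ
    c = Dᶻ k
    Lk : ℤ
    Lk = lin P Q (suc k)
    lemma : ∀ P Q b c x N → b * b * N ≡ Q * Q * - + 1 + x * (P * b - Q * c) → Q * Q + x * (Q * c + - P * b) ≡ b * b * - N
    lemma P Q b c x N h = trans (lemma₂ P Q b c x) (trans (cong -_ (sym h)) (lemma₃ b N))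
      where
      lemma₂ : ∀ P Q b c x → Q * Q + x * (Q * c + - P * b) ≡ - (Q * Q * - + 1 + x * (P * b - Q * c))
      lemma₂ = solve-∀
      lemma₃ : ∀ b N → - (b * b * N) ≡ b * b * - N
      lemma₃ = solve-∀
    e : Q * Q + Lk * (Q * c + - P * b) ≡ b * b * - norm P Q
    e = lemma P Q b c Lk (norm P Q) (trans (norm-cassini P Q k) (cong (λ z → Q * Q * z + Lk * (P * b - Q * c)) hc))

  αPos-cassini± : ∀ {P Q} → αPos P Q →
    (Σ ℕ λ k → cassini (suc k) ≡ + 1 × 0ℤ ℤ.< lin P Q (suc k)) × (Σ ℕ λ k → cassini (suc k) ≡ - + 1 × 0ℤ ℤ.< lin P Q (suc k))
  αPos-cassini± {P} {Q} (n , x) with PositiveAt-suc x | cassini-±1 (suc n)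
  ... | (l₁ , l₂) | inj₁ e = (n , e , l₁) , (suc n , trans (cassini-suc (suc n)) (cong -_ e) , l₂)
  ... | (l₁ , l₂) | inj₂ e = (suc n , trans (cassini-suc (suc n)) (cong -_ e) , l₂) , (n , e , l₁)

  E : ℕ → ℤ
  E n = + 2 * Dᶻ (suc n) - δ * Dᶻ n

  E-nonNeg : ∀ n → 0ℤ ℤ.≤ E n
  E-nonNeg zero = subst (0ℤ ℤ.≤_) (sym (trans (cong₂ (λ x y → + 2 * x - δ * y) (Dᶻ-def 1) (Dᶻ-def 0)) (lemma δ))) (+≤+ ℕ.z≤n)
    where
    lemma : ∀ δ → + 2 * + 1 - δ * + 0 ≡ + 2
    lemma = solve-∀
  E-nonNeg (suc k) = subst (0ℤ ℤ.≤_) (sym (trans (cong (λ z → + 2 * z - δ * Dᶻ (suc k)) (Dᶻ-rec k)) (lemma δ (Dᶻ (suc k)) (Dᶻ k))))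
      (0≤+ (0≤* (0≤pos d) (Dᶻ-nonNeg (suc k))) (0≤* (0≤pos 2) (Dᶻ-nonNeg k)))
    where
    lemma : ∀ δ b c → + 2 * (δ * b + c) - δ * b ≡ δ * b + + 2 * c
    lemma = solve-∀

  -- 2 (P + Qα) = twoRe P Q + Q √(d² + 4)
  twoRe : ℤ → ℤ → ℤ
  twoRe P Q = + 2 * P + Q * δ

  private
    DD : ℤ
    DD = + discr d

    DD≡ : DD ≡ δ * δ + + 4
    DD≡ = trans (ℤP.pos-+ (d ℕ.* d) 4) (cong (_+ + 4) (ℤP.pos-* d d))

  -- 2 (P Dₙ + Q Dₙ₊₁) = twoRe P Q Dₙ + Q Eₙ with Eₙ ≥ 0
  αPos-sign : ∀ {P Q} → αPos P Q → (0ℤ ℤ.< twoRe P Q) ⊎ (0ℤ ℤ.< Q)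
  αPos-sign {P} {Q} (n , x , _) with 0ℤ ℤ.<? twoRe P Q | 0ℤ ℤ.<? Q
  ... | yes h | _ = inj₁ h
  ... | no _ | yes h = inj₂ h
  ... | no ¬a | no ¬q = ⊥-elim (ℤP.<⇒≱ (0<* 0<2 x) (subst (ℤ._≤ 0ℤ) e le))
    where
    A : ℤ
    A = twoRe P Q
    na : 0ℤ ℤ.≤ - A
    na = ℤP.neg-mono-≤ (ℤP.≮⇒≥ ¬a)
    nq : 0ℤ ℤ.≤ - Q
    nq = ℤP.neg-mono-≤ (ℤP.≮⇒≥ ¬q)
    s : 0ℤ ℤ.≤ - A * Dᶻ n + - Q * E n
    s = 0≤+ (0≤* na (Dᶻ-nonNeg n)) (0≤* nq (E-nonNeg n))
    le : - (- A * Dᶻ n + - Q * E n) ℤ.≤ 0ℤ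
    le = ℤP.neg-mono-≤ s
    lemma : ∀ P Q δ a b → - (- (+ 2 * P + Q * δ) * a + - Q * (+ 2 * b - δ * a)) ≡ + 2 * (P * a + Q * b)
    lemma = solve-∀
    e : - (- A * Dᶻ n + - Q * E n) ≡ + 2 * lin P Q n
    e = trans (lemma P Q δ (Dᶻ n) (Dᶻ (suc n))) (cong (+ 2 *_) (sym (lin-def P Q n)))

  twoRe²-DQ² : ∀ P Q → twoRe P Q * twoRe P Q - DD * (Q * Q) ≡ + 4 * norm P Q
  twoRe²-DQ² P Q = trans (cong (λ D → twoRe P Q * twoRe P Q - D * (Q * Q)) DD≡) (lemma P Q δ)
    where
    lemma : ∀ P Q δ → (+ 2 * P + Q * δ) * (+ 2 * P + Q * δ) - (δ * δ + + 4) * (Q * Q) ≡ + 4 * (P * P + P * Q * δ - Q * Q)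
    lemma = solve-∀

  αPos-negativeQ : ∀ {P Q} → αPos P Q → Q ℤ.< 0ℤ → DD * (Q * Q) ℤ.< twoRe P Q * twoRe P Q
  αPos-negativeQ {P} {Q} p hq with proj₁ (αPos-cassini± p)
  ... | k , hc , hl =
    0<-⇒< (subst (0ℤ ℤ.<_) (sym (twoRe²-DQ² P Q)) (0<* 0<4 (norm-pos P Q k hc hl (subst (0ℤ ℤ.<_) (ℤP.+-identityˡ (- Q)) (<⇒0<- hq)))))

  αPos-negativeTwoRe : ∀ {P Q} → αPos P Q → twoRe P Q ℤ.< 0ℤ → 0ℤ ℤ.< Q → twoRe P Q * twoRe P Q ℤ.< DD * (Q * Q)
  αPos-negativeTwoRe {P} {Q} p ha hq with proj₂ (αPos-cassini± p)
  ... | k , hc , hl = 0<-⇒< (subst (0ℤ ℤ.<_) (sym e) (0<* 0<4 (norm-neg P Q k hc hl hp hq)))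
    where
    A : ℤ
    A = twoRe P Q
    nA : 0ℤ ℤ.< - A
    nA = subst (0ℤ ℤ.<_) (ℤP.+-identityˡ (- A)) (<⇒0<- ha)
    lemma₁ : ∀ P Q δ → + 2 * - P ≡ - (+ 2 * P + Q * δ) + Q * δ
    lemma₁ = solve-∀
    hp : 0ℤ ℤ.< - P
    hp = 0<*-cancelˡ (0≤pos 2) (subst (0ℤ ℤ.<_) (sym (lemma₁ P Q δ)) (0<+ nA (0≤* (ℤP.<⇒≤ hq) (0≤pos d))))
    lemma₂ : ∀ P Q δ → (δ * δ + + 4) * (Q * Q) - (+ 2 * P + Q * δ) * (+ 2 * P + Q * δ) ≡ + 4 * - (P * P + P * Q * δ - Q * Q)
    lemma₂ = solve-∀
    e : DD * (Q * Q) - A * A ≡ + 4 * - norm P Q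
    e = trans (cong (λ D → D * (Q * Q) - A * A) DD≡) (lemma₂ P Q δ)

  αPos⇒SqrtPositive : ∀ {P Q} → αPos P Q → SqrtPositive (discr d) (+ 2 * P + Q * + d) Q
  αPos⇒SqrtPositive p = αPos-sign p , αPos-negativeQ p , αPos-negativeTwoRe p

-- beattyArg d m computed in the coordinates (a, b) ↦ a + b √(d² + 4) over ℚ,
-- with Δ = d, M = m and R = 1/d; the identities hold modulo R Δ = 1.
module BeattyArgument (d : ℕ) (1≤d : 1 ℕ.≤ d) (m : ℕ) where

  open import Data.Rational as Q using (ℚ; 0ℚ; 1ℚ; ½; _+_; _*_; _-_; -_)
  open import Data.Rational.Solver using (module +-*-Solver)
  open +-*-Solver using (solve; _:=_; _:+_; _:-_; _:*_; :-_; con)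
  open import Data.Rational.Unnormalised as U using (mkℚᵘ)
  open import Data.Integer as ℤ using (ℤ; +_)
  import Data.Integer.Properties as ℤP
  open import Data.Product using (_,_)
  open import Relation.Binary.PropositionalEquality
  open RationalEmbedding
  open QuadraticField
  open BeattyForm d
  open QuadraticSigns (½/ d) ⦃ ½/-positive 1≤d ⦄ (discr d) using (scaled)

  private
    D : ℕ
    D = discr d
    α : QSqrt
    α = alpha d
    Δ : ℚ
    Δ = ⌜ + d ⌝
    M : ℚ
    M = ⌜ + m ⌝
    R : ℚ
    R = toℚ (recipQ (ι (+ d)))
    four : ℚ
    four = ⌜ + 4 ⌝

    RΔ≡1 : R * Δ ≡ 1ℚ
    RΔ≡1 = toℚ-recipQ (ι (+ d)) (⌜+⌝≢0 1≤d)

    ⌜D⌝ : ⌜ + D ⌝ ≡ Δ * Δ + four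
    ⌜D⌝ = trans (cong ⌜_⌝ (ℤP.pos-+ (d ℕ.* d) 4))
                (trans (⌜⌝-+ (+ (d ℕ.* d)) (+ 4)) (cong (_+ four) (trans (cong ⌜_⌝ (ℤP.pos-* d d)) (⌜⌝-* (+ d) (+ d)))))

    modulo-RΔ : ∀ {x y} E → x ≡ y + E * (R * Δ - 1ℚ) → x ≡ y
    modulo-RΔ {x} {y} E eq = trans eq (trans (cong (λ z → y + E * (z - 1ℚ)) RΔ≡1) (lemma y E))
      where
      lemma : ∀ y E → y + E * (1ℚ - 1ℚ) ≡ y
      lemma = solve 2 (λ y E → y :+ E :* (con 1ℚ :- con 1ℚ) := y) refl

    inverse-unique : ∀ {r x} s → r * x ≡ 1ℚ → x ≡ s * Δ → s * s ≡ 1ℚ → r ≡ s * R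
    inverse-unique {r} {x} s rx≡1 x≡sΔ ss≡1 = begin
      r                              ≡⟨ lemma₁ r ⟩
      r * 1ℚ * 1ℚ                    ≡⟨ sym (cong₂ (λ a b → r * a * b) RΔ≡1 ss≡1) ⟩
      r * (R * Δ) * (s * s)          ≡⟨ lemma₂ r R Δ s ⟩
      s * R * (r * (s * Δ))          ≡⟨ cong (λ z → s * R * (r * z)) (sym x≡sΔ) ⟩
      s * R * (r * x)                ≡⟨ cong (λ z → s * R * z) rx≡1 ⟩
      s * R * 1ℚ                     ≡⟨ lemma₃ (s * R) ⟩
      s * R                          ∎
      where
      open ≡-Reasoning
      lemma₁ : ∀ r → r ≡ r * 1ℚ * 1ℚ
      lemma₁ = solve 1 (λ r → r := r :* con 1ℚ :* con 1ℚ) refl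
      lemma₂ : ∀ r R Δ s → r * (R * Δ) * (s * s) ≡ s * R * (r * (s * Δ))
      lemma₂ = solve 4 (λ r R Δ s → r :* (R :* Δ) :* (s :* s) := s :* R :* (r :* (s :* Δ))) refl
      lemma₃ : ∀ x → x * 1ℚ ≡ x
      lemma₃ = solve 1 (λ x → x :* con 1ℚ := x) refl

  ⟦α⟧ : ⟦ α ⟧ ≡ (Δ * ½ , ½)
  ⟦α⟧ = cong (_, ½) (trans (toℚ-cong {mkℚᵘ (+ d) 1} {ι (+ d) U.* mkℚᵘ (+ 1) 1}
                                        (U.*≡* (cong (ℤ._* + 2) (sym (ℤP.*-identityʳ (+ d))))))
                             (toℚ-* (ι (+ d)) (mkℚᵘ (+ 1) 1)))

  α-1 α[α-1] : QSqrt
  α-1 = α ⊝ fromℤ (+ 1)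
  α[α-1] = mul D α α-1

  ⟦α-1⟧ : ⟦ α-1 ⟧ ≡ (Δ * ½ - 1ℚ , ½)
  ⟦α-1⟧ = trans (⟦⊝⟧ α (fromℤ (+ 1))) (cong (λ a → add2 a (neg2 (1ℚ , 0ℚ))) ⟦α⟧)

  ⟦α[α-1]⟧ : ⟦ α[α-1] ⟧ ≡ ((Δ * Δ - Δ) * ½ + 1ℚ , (Δ - 1ℚ) * ½)
  ⟦α[α-1]⟧ = begin
    ⟦ α[α-1] ⟧                                            ≡⟨ ⟦mul⟧ D α α-1 ⟩
    mul2 ⌜ + D ⌝ ⟦ α ⟧ ⟦ α-1 ⟧                            ≡⟨ cong₂ (mul2 ⌜ + D ⌝) ⟦α⟧ ⟦α-1⟧ ⟩
    mul2 ⌜ + D ⌝ (Δ * ½ , ½) (Δ * ½ - 1ℚ , ½)             ≡⟨ cong (λ D → mul2 D (Δ * ½ , ½) (Δ * ½ - 1ℚ , ½)) ⌜D⌝ ⟩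
    mul2 (Δ * Δ + four) (Δ * ½ , ½) (Δ * ½ - 1ℚ , ½)      ≡⟨ cong₂ _,_ (re-identity Δ) (ir-identity Δ) ⟩
    ((Δ * Δ - Δ) * ½ + 1ℚ , (Δ - 1ℚ) * ½)                  ∎
    where
    open ≡-Reasoning
    re-identity : ∀ Δ → Δ * ½ * (Δ * ½ - 1ℚ) + (Δ * Δ + four) * (½ * ½) ≡ (Δ * Δ - Δ) * ½ + 1ℚ
    re-identity = solve 1 (λ Δ → Δ :* con ½ :* (Δ :* con ½ :- con 1ℚ) :+ (Δ :* Δ :+ con four) :* (con ½ :* con ½)
                                 := (Δ :* Δ :- Δ) :* con ½ :+ con 1ℚ) refl
    ir-identity : ∀ Δ → Δ * ½ * ½ + ½ * (Δ * ½ - 1ℚ) ≡ (Δ - 1ℚ) * ½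
    ir-identity = solve 1 (λ Δ → Δ :* con ½ :* con ½ :+ con ½ :* (Δ :* con ½ :- con 1ℚ) := (Δ :- con 1ℚ) :* con ½) refl

  private
    r₁ r₂ : ℚ
    r₁ = toℚ (recipQ (normᵘ D α-1))
    r₂ = toℚ (recipQ (normᵘ D α[α-1]))

    norm-α-1 : toℚ (normᵘ D α-1) ≡ - Δ
    norm-α-1 = begin
      toℚ (normᵘ D α-1)                       ≡⟨ ⟦norm⟧ D α-1 ⟩
      norm2 ⌜ + D ⌝ ⟦ α-1 ⟧                    ≡⟨ cong₂ norm2 ⌜D⌝ ⟦α-1⟧ ⟩
      norm2 (Δ * Δ + four) (Δ * ½ - 1ℚ , ½)    ≡⟨ identity Δ ⟩
      - Δ                                      ∎
      where
      open ≡-Reasoning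
      identity : ∀ Δ → (Δ * ½ - 1ℚ) * (Δ * ½ - 1ℚ) - (Δ * Δ + four) * (½ * ½) ≡ - Δ
      identity = solve 1 (λ Δ → (Δ :* con ½ :- con 1ℚ) :* (Δ :* con ½ :- con 1ℚ) :- (Δ :* Δ :+ con four) :* (con ½ :* con ½)
                               := :- Δ) refl

    norm-α[α-1] : toℚ (normᵘ D α[α-1]) ≡ Δ
    norm-α[α-1] = begin
      toℚ (normᵘ D α[α-1])                                        ≡⟨ ⟦norm⟧ D α[α-1] ⟩
      norm2 ⌜ + D ⌝ ⟦ α[α-1] ⟧                                     ≡⟨ cong₂ norm2 ⌜D⌝ ⟦α[α-1]⟧ ⟩
      norm2 (Δ * Δ + four) ((Δ * Δ - Δ) * ½ + 1ℚ , (Δ - 1ℚ) * ½)   ≡⟨ identity Δ ⟩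
      Δ                                                            ∎
      where
      open ≡-Reasoning
      identity : ∀ Δ → ((Δ * Δ - Δ) * ½ + 1ℚ) * ((Δ * Δ - Δ) * ½ + 1ℚ) - (Δ * Δ + four) * ((Δ - 1ℚ) * ½ * ((Δ - 1ℚ) * ½)) ≡ Δ
      identity = solve 1 (λ Δ → ((Δ :* Δ :- Δ) :* con ½ :+ con 1ℚ) :* ((Δ :* Δ :- Δ) :* con ½ :+ con 1ℚ)
                                 :- (Δ :* Δ :+ con four) :* ((Δ :- con 1ℚ) :* con ½ :* ((Δ :- con 1ℚ) :* con ½))
                               := Δ) refl

    r₁≡-R : r₁ ≡ - R
    r₁≡-R = trans (inverse-unique (- 1ℚ) (toℚ-recipQ (normᵘ D α-1) norm≢0) (trans norm-α-1 (lemma₁ Δ)) refl) (lemma₂ R)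
      where
      lemma₁ : ∀ Δ → - Δ ≡ - 1ℚ * Δ
      lemma₁ = solve 1 (λ Δ → :- Δ := :- con 1ℚ :* Δ) refl
      lemma₂ : ∀ R → - 1ℚ * R ≡ - R
      lemma₂ = solve 1 (λ R → :- con 1ℚ :* R := :- R) refl
      lemma₃ : ∀ Δ → Δ ≡ - (- Δ)
      lemma₃ = solve 1 (λ Δ → Δ := :- (:- Δ)) refl
      norm≢0 : toℚ (normᵘ D α-1) ≢ 0ℚ
      norm≢0 e = ⌜+⌝≢0 1≤d (trans (lemma₃ Δ) (trans (cong -_ (sym norm-α-1)) (cong -_ e)))

    r₂≡R : r₂ ≡ R
    r₂≡R = trans (inverse-unique 1ℚ (toℚ-recipQ (normᵘ D α[α-1]) norm≢0) (trans norm-α[α-1] (lemma₁ Δ)) refl) (lemma₂ R)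
      where
      lemma₁ : ∀ Δ → Δ ≡ 1ℚ * Δ
      lemma₁ = solve 1 (λ Δ → Δ := con 1ℚ :* Δ) refl
      lemma₂ : ∀ R → 1ℚ * R ≡ R
      lemma₂ = solve 1 (λ R → con 1ℚ :* R := R) refl
      norm≢0 : toℚ (normᵘ D α[α-1]) ≢ 0ℚ
      norm≢0 e = ⌜+⌝≢0 1≤d (trans (sym norm-α[α-1]) e)

  ⟦mα/[α-1]⟧ : ⟦ divide D (mul D (fromℤ (+ m)) α) α-1 ⟧ ≡ (M * (½ + R) , M * R * ½)
  ⟦mα/[α-1]⟧ = begin
    ⟦ divide D (mul D (fromℤ (+ m)) α) α-1 ⟧
      ≡⟨ ⟦mul⟧ D (mul D (fromℤ (+ m)) α) (inv D α-1) ⟩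
    mul2 ⌜ + D ⌝ ⟦ mul D (fromℤ (+ m)) α ⟧ ⟦ inv D α-1 ⟧
      ≡⟨ cong₂ (mul2 ⌜ + D ⌝) (trans (⟦mul⟧ D (fromℤ (+ m)) α) (cong (mul2 ⌜ + D ⌝ (M , 0ℚ)) ⟦α⟧))
                              (trans (⟦inv⟧ D α-1) (cong₂ inv2 r₁≡-R ⟦α-1⟧)) ⟩
    mul2 ⌜ + D ⌝ (mul2 ⌜ + D ⌝ (M , 0ℚ) (Δ * ½ , ½)) (inv2 (- R) (Δ * ½ - 1ℚ , ½))
      ≡⟨ cong (λ D → mul2 D (mul2 D (M , 0ℚ) (Δ * ½ , ½)) (inv2 (- R) (Δ * ½ - 1ℚ , ½))) ⌜D⌝ ⟩
    mul2 (Δ * Δ + four) (mul2 (Δ * Δ + four) (M , 0ℚ) (Δ * ½ , ½)) (inv2 (- R) (Δ * ½ - 1ℚ , ½))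
      ≡⟨ cong₂ _,_ (modulo-RΔ (M * ½) (re-identity Δ M R)) (ir-identity Δ M R) ⟩
    (M * (½ + R) , M * R * ½) ∎
    where
    open ≡-Reasoning
    re-identity : ∀ Δ M R →
      (M * (Δ * ½) + (Δ * Δ + four) * (0ℚ * ½)) * ((Δ * ½ - 1ℚ) * - R)
        + (Δ * Δ + four) * ((M * ½ + 0ℚ * (Δ * ½)) * - (½ * - R))
      ≡ M * (½ + R) + M * ½ * (R * Δ - 1ℚ)
    re-identity = solve 3 (λ Δ M R →
      (M :* (Δ :* con ½) :+ (Δ :* Δ :+ con four) :* (con 0ℚ :* con ½)) :* ((Δ :* con ½ :- con 1ℚ) :* :- R)
        :+ (Δ :* Δ :+ con four) :* ((M :* con ½ :+ con 0ℚ :* (Δ :* con ½)) :* :- (con ½ :* :- R))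
      := M :* (con ½ :+ R) :+ M :* con ½ :* (R :* Δ :- con 1ℚ)) refl
    ir-identity : ∀ Δ M R →
      (M * (Δ * ½) + (Δ * Δ + four) * (0ℚ * ½)) * - (½ * - R) + (M * ½ + 0ℚ * (Δ * ½)) * ((Δ * ½ - 1ℚ) * - R)
      ≡ M * R * ½
    ir-identity = solve 3 (λ Δ M R →
      (M :* (Δ :* con ½) :+ (Δ :* Δ :+ con four) :* (con 0ℚ :* con ½)) :* :- (con ½ :* :- R)
        :+ (M :* con ½ :+ con 0ℚ :* (Δ :* con ½)) :* ((Δ :* con ½ :- con 1ℚ) :* :- R)
      := M :* R :* con ½) refl

  ⟦1/α[α-1]⟧ : ⟦ divide D (fromℤ (+ 1)) α[α-1] ⟧ ≡ (Δ * ½ - ½ + R , R * ½ - ½)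
  ⟦1/α[α-1]⟧ = begin
    ⟦ divide D (fromℤ (+ 1)) α[α-1] ⟧
      ≡⟨ ⟦mul⟧ D (fromℤ (+ 1)) (inv D α[α-1]) ⟩
    mul2 ⌜ + D ⌝ (1ℚ , 0ℚ) ⟦ inv D α[α-1] ⟧
      ≡⟨ cong (mul2 ⌜ + D ⌝ (1ℚ , 0ℚ)) (trans (⟦inv⟧ D α[α-1]) (cong₂ inv2 r₂≡R ⟦α[α-1]⟧)) ⟩
    mul2 ⌜ + D ⌝ (1ℚ , 0ℚ) (inv2 R ((Δ * Δ - Δ) * ½ + 1ℚ , (Δ - 1ℚ) * ½))
      ≡⟨ cong₂ _,_ (modulo-RΔ (Δ * ½ - ½) (re-identity Δ ⌜ + D ⌝ R)) (modulo-RΔ (- ½) (ir-identity Δ R)) ⟩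
    (Δ * ½ - ½ + R , R * ½ - ½) ∎
    where
    open ≡-Reasoning
    re-identity : ∀ Δ D R → 1ℚ * (((Δ * Δ - Δ) * ½ + 1ℚ) * R) + D * (0ℚ * - ((Δ - 1ℚ) * ½ * R))
                            ≡ Δ * ½ - ½ + R + (Δ * ½ - ½) * (R * Δ - 1ℚ)
    re-identity = solve 3 (λ Δ D R →
      con 1ℚ :* (((Δ :* Δ :- Δ) :* con ½ :+ con 1ℚ) :* R) :+ D :* (con 0ℚ :* :- ((Δ :- con 1ℚ) :* con ½ :* R))
      := Δ :* con ½ :- con ½ :+ R :+ (Δ :* con ½ :- con ½) :* (R :* Δ :- con 1ℚ)) refl
    ir-identity : ∀ Δ R → 1ℚ * - ((Δ - 1ℚ) * ½ * R) + 0ℚ * (((Δ * Δ - Δ) * ½ + 1ℚ) * R)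
                          ≡ R * ½ - ½ + - ½ * (R * Δ - 1ℚ)
    ir-identity = solve 2 (λ Δ R →
      con 1ℚ :* :- ((Δ :- con 1ℚ) :* con ½ :* R) :+ con 0ℚ :* (((Δ :* Δ :- Δ) :* con ½ :+ con 1ℚ) :* R)
      := R :* con ½ :- con ½ :+ :- con ½ :* (R :* Δ :- con 1ℚ)) refl

  ⟦beattyArg⟧ : ⟦ beattyArg d m ⟧ ≡ (M * (½ + R) - (Δ * ½ - ½ + R) , M * R * ½ - (R * ½ - ½))
  ⟦beattyArg⟧ = trans (⟦⊝⟧ (divide D (mul D (fromℤ (+ m)) α) α-1) (divide D (fromℤ (+ 1)) α[α-1]))
                      (cong₂ (λ x y → add2 x (neg2 y)) ⟦mα/[α-1]⟧ ⟦1/α[α-1]⟧)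

  private
    two : ℚ
    two = ⌜ + 2 ⌝

    ⌜beattyQ⌝ : ⌜ beattyQ m ⌝ ≡ M + Δ - 1ℚ
    ⌜beattyQ⌝ = trans (⌜⌝-sub (+ m ℤ.+ + d) (+ 1)) (cong (_- 1ℚ) (⌜⌝-+ (+ m) (+ d)))

    ⌜beattyA⌝ : ∀ t → ⌜ beattyA m t ⌝ ≡ two * ((M + Δ - 1ℚ) - Δ * (⌜ t ⌝ + Δ)) + (M + Δ - 1ℚ) * Δ
    ⌜beattyA⌝ t = begin
      ⌜ + 2 ℤ.* beattyP m t ℤ.+ beattyQ m ℤ.* + d ⌝       ≡⟨ ⌜⌝-+ (+ 2 ℤ.* beattyP m t) (beattyQ m ℤ.* + d) ⟩
      ⌜ + 2 ℤ.* beattyP m t ⌝ + ⌜ beattyQ m ℤ.* + d ⌝      ≡⟨ cong₂ _+_ (⌜⌝-* (+ 2) (beattyP m t)) (⌜⌝-* (beattyQ m) (+ d)) ⟩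
      two * ⌜ beattyP m t ⌝ + ⌜ beattyQ m ⌝ * Δ            ≡⟨ cong₂ (λ p q → two * p + q * Δ) ⌜beattyP⌝ ⌜beattyQ⌝ ⟩
      two * ((M + Δ - 1ℚ) - Δ * (⌜ t ⌝ + Δ)) + (M + Δ - 1ℚ) * Δ ∎
      where
      open ≡-Reasoning
      ⌜beattyP⌝ : ⌜ beattyP m t ⌝ ≡ (M + Δ - 1ℚ) - Δ * (⌜ t ⌝ + Δ)
      ⌜beattyP⌝ = trans (⌜⌝-sub (beattyQ m) (+ d ℤ.* (t ℤ.+ + d)))
                        (cong₂ _-_ ⌜beattyQ⌝ (trans (⌜⌝-* (+ d) (t ℤ.+ + d)) (cong (Δ *_) (⌜⌝-+ t (+ d)))))

    ⟦scaled⟧ : ∀ A B → ⟦ scaled A B ⟧ ≡ (⌜ A ⌝ * (½ * R) , ⌜ B ⌝ * (½ * R))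
    ⟦scaled⟧ A B = cong₂ _,_ (trans (toℚ-* (ι A) (½/ d)) (cong (⌜ A ⌝ *_) (toℚ-* (mkℚᵘ (+ 1) 1) (recipQ (ι (+ d))))))
                              (trans (toℚ-* (ι B) (½/ d)) (cong (⌜ B ⌝ *_) (toℚ-* (mkℚᵘ (+ 1) 1) (recipQ (ι (+ d))))))

  ⟦beattyArg⊝⟧ : ∀ t → ⟦ beattyArg d m ⊝ fromℤ t ⟧ ≡ ⟦ scaled (beattyA m t) (beattyQ m) ⟧
  ⟦beattyArg⊝⟧ t = begin
    ⟦ beattyArg d m ⊝ fromℤ t ⟧
      ≡⟨ trans (⟦⊝⟧ (beattyArg d m) (fromℤ t)) (cong (λ y → add2 y (neg2 (T , 0ℚ))) ⟦beattyArg⟧) ⟩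
    (M * (½ + R) - (Δ * ½ - ½ + R) - T , M * R * ½ - (R * ½ - ½) - 0ℚ)
      ≡⟨ cong₂ _,_ (modulo-RΔ (T + Δ * ½ - M * ½ - ½) (re-identity Δ M R T)) (modulo-RΔ (- ½) (ir-identity Δ M R)) ⟩
    ((two * ((M + Δ - 1ℚ) - Δ * (T + Δ)) + (M + Δ - 1ℚ) * Δ) * (½ * R) , (M + Δ - 1ℚ) * (½ * R))
      ≡⟨ sym (trans (⟦scaled⟧ (beattyA m t) (beattyQ m)) (cong₂ (λ a q → (a * (½ * R) , q * (½ * R))) (⌜beattyA⌝ t) ⌜beattyQ⌝)) ⟩
    ⟦ scaled (beattyA m t) (beattyQ m) ⟧ ∎
    where
    open ≡-Reasoning
    T : ℚ
    T = ⌜ t ⌝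
    re-identity : ∀ Δ M R T →
      M * (½ + R) - (Δ * ½ - ½ + R) - T
      ≡ (two * ((M + Δ - 1ℚ) - Δ * (T + Δ)) + (M + Δ - 1ℚ) * Δ) * (½ * R) + (T + Δ * ½ - M * ½ - ½) * (R * Δ - 1ℚ)
    re-identity = solve 4 (λ Δ M R T →
      M :* (con ½ :+ R) :- (Δ :* con ½ :- con ½ :+ R) :- T
      := (con two :* ((M :+ Δ :- con 1ℚ) :- Δ :* (T :+ Δ)) :+ (M :+ Δ :- con 1ℚ) :* Δ) :* (con ½ :* R)
         :+ (T :+ Δ :* con ½ :- M :* con ½ :- con ½) :* (R :* Δ :- con 1ℚ)) refl
    ir-identity : ∀ Δ M R → M * R * ½ - (R * ½ - ½) - 0ℚ ≡ (M + Δ - 1ℚ) * (½ * R) + - ½ * (R * Δ - 1ℚ)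
    ir-identity = solve 3 (λ Δ M R →
      M :* R :* con ½ :- (R :* con ½ :- con ½) :- con 0ℚ
      := (M :+ Δ :- con 1ℚ) :* (con ½ :* R) :+ :- con ½ :* (R :* Δ :- con 1ℚ)) refl

beattyArg-floor : ∀ {d m n} (2≤d : 2 ℕ.≤ d) → Shifts.IsNthNonShift d 2≤d m n → IsFloor (discr d) (+ n) (beattyArg d m)
beattyArg-floor {d} {m} {n} 2≤d nth = lower , upper
  where
  open import Data.Nat using (z≤n; s≤s)
  open import Data.Integer.Properties using (neg-involutive)
  open import Data.Integer.Tactic.RingSolver using (solve-∀)
  open import Relation.Binary.PropositionalEquality using (cong₂; sym; trans)
  open RationalEmbedding using (½/; ½/-positive)
  open QuadraticField using (⟦_⟧; ⟦⟧-injective; NonNeg-resp)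
  open BeattyForm d
  open BeattyInequalities d 2≤d using (beatty-lower; beatty-upper)
  open NormBridge d using (αPos⇒SqrtPositive)
  1≤d : 1 ℕ.≤ d
  1≤d = ℕP.≤-trans (s≤s z≤n) 2≤d
  open BeattyArgument d 1≤d m using (⟦beattyArg⊝⟧)
  open QuadraticSigns (½/ d) ⦃ ½/-positive 1≤d ⦄ (discr d)

  lower : Leq (discr d) (fromℤ (+ n)) (beattyArg d m)
  lower = NonNeg-resp (discr d) (⟦⟧-injective (sym (⟦beattyArg⊝⟧ (+ n))))
                      (SqrtPositive⇒NonNeg _ _ (αPos⇒SqrtPositive (beatty-lower nth)))

  upper : Less (discr d) (beattyArg d m) (fromℤ (+ n ℤ.+ + 1))
  upper nonNeg = SqrtPositive⇒¬NonNeg-neg _ _ 1≤discr (αPos⇒SqrtPositive (beatty-upper nth))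
                   (NonNeg-resp (discr d) (⟦⟧-injective (trans (⟦beattyArg⊝⟧ (+ n ℤ.+ + 1)) negated)) nonNeg)
    where
    1≤discr : 1 ℕ.≤ discr d
    1≤discr = ℕP.≤-trans (s≤s z≤n) (ℕP.m≤n+m 4 (d ℕ.* d))
    lemma : ∀ P Q δ → + 2 ℤ.* P ℤ.+ Q ℤ.* δ ≡ ℤ.- (+ 2 ℤ.* ℤ.- P ℤ.+ ℤ.- Q ℤ.* δ)
    lemma = solve-∀
    negated : ⟦ scaled (beattyA m (+ n ℤ.+ + 1)) (beattyQ m) ⟧
              ≡ ⟦ scaled (ℤ.- (+ 2 ℤ.* ℤ.- beattyP m (+ n ℤ.+ + 1) ℤ.+ ℤ.- beattyQ m ℤ.* + d)) (ℤ.- ℤ.- beattyQ m) ⟧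
    negated = cong₂ (λ a b → ⟦ scaled a b ⟧) (lemma (beattyP m (+ n ℤ.+ + 1)) (beattyQ m) (+ d)) (sym (neg-involutive (beattyQ m)))

open import Data.Nat using (_≤_)
open import Data.Product using (Σ)

corollary2 : (d : ℕ) → 2 ≤ d → (m : ℕ) → 1 ≤ m →
    Σ ℕ (λ a → OstrowskiArrayEntry d m 1 a)
    × ((a : ℕ) → OstrowskiArrayEntry d m 1 a → IsFloor (discr d) (+ a) (beattyArg d m))
corollary2 d 2≤d m 1≤m with n , nth ← Shifts.nthNonShift d 2≤d m 1≤m =
  (value d (ostrowski n) , ostrowski n , ostrowski-IsMthTrimmed nth , refl) , floor
  where
  open import Relation.Binary.PropositionalEquality using (refl)
  open OstrowskiNumeration d 2≤d using (ostrowski)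
  open FirstColumn d 2≤d using (ostrowski-IsMthTrimmed; IsMthTrimmed⇒IsNthNonShift)
  floor : (a : ℕ) → OstrowskiArrayEntry d m 1 a → IsFloor (discr d) (+ a) (beattyArg d m)
  floor a (w , mth , refl) = beattyArg-floor 2≤d (IsMthTrimmed⇒IsNthNonShift 1≤m mth)
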